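{- Let $r\ge -1$, $k\ge0$ and integers $1\le a_1\le\dots\le a_k\le r$ with $a_i-a_{i-1}\ge2$ for $2\le i\le k$, and suppose that $a_1,\dots,a_k$ are all odd. Then \[ q(r;a_1,\dots,a_k)=\begin{cases}2k(-1)^{r/2+1}&\text{if }r\text{ is even},\\(2k+1)(-1)^{(r+1)/2}&\text{if }r\text{ is odd.}\end{cases} \]
   Context: All graphs are finite and simple. Adding a $2$-house to an edge $uv$ means adding two new vertices $x,y$ and all edges among $\{u,v,x,y\}$. $Q(r;a_1,\dots,a_k)$ is the graph obtained from a path with $r$ edges ($r+1$ vertices) by adding a $2$-house on the $a_i$-th edge of the path for each $i$; $Q(-1)$ is the graph with no vertices. An elementary subgraph is a subgraph each of whose components is a cycle or a single edge; it is spanning if it contains all vertices. For such $X$ with $c$ edge-components and $d$ cycle-components, $\beta(X)=(-1)^c(-2)^d$. $q(r;a_1,\dots,a_k)$ is the sum of $\beta(X)$ over all spanning elementary subgraphs $X$ of $Q(r;a_1,\dots,a_k)$ (for the empty graph this sum is $1$). -}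

module Defs where

open import Data.Bool using (Bool; true; false; _∧_; _∨_; not; if_then_else_)
open import Data.Nat as ℕ using (ℕ; zero; suc; _≡ᵇ_; _<ᵇ_; _≤ᵇ_; _∸_)
open import Data.Integer as ℤ using (ℤ; +_; -[1+_]; ∣_∣)
open import Data.Fin using (Fin; toℕ)
open import Data.List using (List; []; _∷_; _++_; map; length; filterᵇ; upTo; allFin; concatMap; foldr)
open import Data.Bool.ListAction using (any; all)
open import Data.Product using (_×_; _,_)

-- Finite simple graphs with vertex set {0, …, n-1}, given by an edge list
-- (each edge listed once, as an unordered pair).

record Graph : Set where
  constructor graph
  field
    nv    : ℕ
    edges : List (ℕ × ℕ)
open Graph public

-- The graph Q(r; a_1,…,a_k), described via m = r + 1 = number of path
-- vertices.  Path vertices: 0,…,m-1; the j-th edge (1-indexed) of the path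
-- joins j-1 and j.  The 2-house on the a_i-th edge (i = 0,…,k-1) adds the
-- new vertices x_i = m + 2i and y_i = m + 2i + 1 and all edges among
-- {a_i - 1, a_i, x_i, y_i} (the edge {a_i - 1, a_i} is already present).

pathEdges : ℕ → List (ℕ × ℕ)
pathEdges m = map (λ j → (j , suc j)) (upTo (m ∸ 1))

houseEdges : (m : ℕ) {k : ℕ} → (Fin k → ℕ) → Fin k → List (ℕ × ℕ)
houseEdges m a i =
  let u = a i ∸ 1
      v = a i
      x = m ℕ.+ 2 ℕ.* toℕ i
      y = suc x
  in (x , y) ∷ (u , x) ∷ (u , y) ∷ (v , x) ∷ (v , y) ∷ []

Qm : (m k : ℕ) → (Fin k → ℕ) → Graph
Qm m k a = graph (m ℕ.+ 2 ℕ.* k) (pathEdges m ++ concatMap (houseEdges m a) (allFin k))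

-- Q(r; a_1,…,a_k) for r ≥ -1 (r = -1 gives the graph with no vertices).
Q : (r : ℤ) (k : ℕ) → (Fin k → ℕ) → Graph
Q r k a = Qm ∣ r ℤ.+ ℤ.1ℤ ∣ k a

-- Spanning subgraphs: all vertices of G, edge set a sub-collection of the
-- edges of G.  They are enumerated by all sublists of the edge list.

sublists : {A : Set} → List A → List (List A)
sublists []       = [] ∷ []
sublists (x ∷ xs) = let s = sublists xs in s ++ map (x ∷_) s

count : {A : Set} → (A → Bool) → List A → ℕ
count p xs = length (filterᵇ p xs)

module _ (n : ℕ) (E : List (ℕ × ℕ)) where

  verts : List ℕ
  verts = upTo n

  adj : ℕ → ℕ → Bool
  adj u v = any (λ { (p , q) → ((u ≡ᵇ p) ∧ (v ≡ᵇ q)) ∨ ((u ≡ᵇ q) ∧ (v ≡ᵇ p)) }) E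

  deg : ℕ → ℕ
  deg u = count (adj u) verts

  reachableIn : ℕ → ℕ → ℕ → Bool
  reachableIn zero    u w = u ≡ᵇ w
  reachableIn (suc s) u w =
    reachableIn s u w ∨ any (λ v → reachableIn s u v ∧ adj v w) verts

  -- same connected component (walks of length ≤ n suffice)
  conn : ℕ → ℕ → Bool
  conn = reachableIn n

  compSize : ℕ → ℕ
  compSize u = count (conn u) verts

  isEdgeComp : ℕ → Bool
  isEdgeComp u = compSize u ≡ᵇ 2

  isCycleComp : ℕ → Bool
  isCycleComp u = (3 ≤ᵇ compSize u) ∧ all (λ w → not (conn u w) ∨ (deg w ≡ᵇ 2)) verts

  isElementary : Bool
  isElementary = all (λ u → isEdgeComp u ∨ isCycleComp u) verts

  -- u is the least vertex of its component (one representative per component)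
  isRep : ℕ → Bool
  isRep u = not (any (λ w → (w <ᵇ u) ∧ conn u w) verts)

  numEdgeComps numCycleComps : ℕ
  numEdgeComps  = count (λ u → isRep u ∧ isEdgeComp u) verts
  numCycleComps = count (λ u → isRep u ∧ isCycleComp u) verts

  β : ℤ
  β = (ℤ.- ℤ.1ℤ) ℤ.^ numEdgeComps ℤ.* (ℤ.- (+ 2)) ℤ.^ numCycleComps

qG : Graph → ℤ
qG G = foldr ℤ._+_ ℤ.0ℤ
  (map (λ E → if isElementary (nv G) E then β (nv G) E else ℤ.0ℤ) (sublists (edges G)))

q : (r : ℤ) (k : ℕ) → (Fin k → ℕ) → ℤ
q r k a = qG (Q r k a)

-- Peel the
-- path of Q from its left end: the first two path vertices, together with the house on the first
-- edge if there is one (they then span a K₄), form a block joined to the rest only by the next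
-- path edge.  A subgraph avoiding this bridge factors as (block) × (rest); one containing it must
-- use it as an edge component, so the rest loses its first vertex.  Writing Z and Z⁻ for the sums
-- of the remaining family and of that family without its first vertex, this yields
--   Z = − Z′ and Z⁻ = − Z′⁻               without a house on the first edge,
--   Z = − 3 Z′ + 2 Z′⁻ and Z⁻ = − 2 Z′ + Z′⁻  with one,
-- the block constants being obtained by evaluating small model graphs.  As every aᵢ is odd, each
-- step has one of these two shapes, and induction gives Z = p(L) (1 + 2k) + p(L + 1) · 2k for a
-- family with L path vertices and k houses, where p(n) is the value for a bare path on n vertices:
-- (−1)^(n/2) for even n and 0 for odd n.

module Submission where

open import Data.Bool using (Bool; true; false; _∧_; _∨_; not; if_then_else_; T)
open import Data.Bool.ListAction using (any; all)
import Data.Bool.Properties as 𝔹ₚ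
open import Data.Empty using (⊥; ⊥-elim)
open import Data.Fin using (Fin; toℕ) renaming (zero to fz; suc to fs)
open import Data.Integer as ℤ using (ℤ; +_; -[1+_]; ∣_∣)
import Data.Integer.Properties as ℤₚ
open import Data.Integer.Solver using (module +-*-Solver)
open import Data.List using (List; []; _∷_; _++_; map; length; filterᵇ; upTo; foldr; applyUpTo; concatMap; allFin)
import Data.List.Properties as Listₚ
open import Data.List.Membership.Propositional using (_∈_; _∉_)
open import Data.List.Membership.Propositional.Properties using (∈-map⁺; ∈-map⁻; ∈-++⁺ˡ; ∈-++⁺ʳ; ∈-++⁻; ∈-filter⁻)
open import Data.List.Relation.Unary.Any using (here; there)
open import Data.List.Relation.Binary.Permutation.Propositional
  using (_↭_; prep; swap; ↭-sym; ↭-reflexive) renaming (refl to ↭refl; trans to ↭trans)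
import Data.List.Relation.Binary.Permutation.Propositional.Properties as ↭ₚ
open import Data.Nat using (ℕ; zero; suc; _≡ᵇ_; _<ᵇ_; _≤ᵇ_; _∸_; _+_; _*_; _≤_; _<_; z≤n; s≤s)
import Data.Nat.Properties as ℕₚ
open import Data.Product using (_×_; _,_; Σ; ∃; proj₁; proj₂)
open import Data.Sum using (_⊎_; inj₁; inj₂; [_,_]′)
open import Data.Unit using (⊤; tt)
open import Relation.Binary using (tri<; tri≈; tri>)
open import Relation.Binary.PropositionalEquality
open import Relation.Nullary using (¬_)
open import Relation.Nullary.Decidable using (T?)

open import Defs

private
  variable
    X Y : Set

∨-true⁻ : ∀ {a b} → a ∨ b ≡ true → (a ≡ true) ⊎ (b ≡ true)
∨-true⁻ {true} _ = inj₁ refl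
∨-true⁻ {false} p = inj₂ p

∧-true⁻ : ∀ {a b} → a ∧ b ≡ true → (a ≡ true) × (b ≡ true)
∧-true⁻ {true} {true} refl = refl , refl

not≡true⁻ : ∀ {b} → not b ≡ true → b ≡ false
not≡true⁻ {false} _ = refl

true≢false : true ≢ false
true≢false ()

bool-ext : ∀ {a b : Bool} → (a ≡ true → b ≡ true) → (b ≡ true → a ≡ true) → a ≡ b
bool-ext {true} {true} f g = refl
bool-ext {true} {false} f g = sym (f refl)
bool-ext {false} {true} f g = g refl
bool-ext {false} {false} f g = refl

T⇒≡true : ∀ {b} → T b → b ≡ true
T⇒≡true {true} _ = refl

≡true⇒T : ∀ {b} → b ≡ true → T b
≡true⇒T refl = tt

≡ᵇ⇒≡ : ∀ {m n} → (m ≡ᵇ n) ≡ true → m ≡ n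
≡ᵇ⇒≡ {m} {n} p = ℕₚ.≡ᵇ⇒≡ m n (≡true⇒T p)

≡⇒≡ᵇ : ∀ m n → m ≡ n → (m ≡ᵇ n) ≡ true
≡⇒≡ᵇ m n p = T⇒≡true (ℕₚ.≡⇒≡ᵇ m n p)

≡ᵇ-refl : ∀ m → (m ≡ᵇ m) ≡ true
≡ᵇ-refl m = ≡⇒≡ᵇ m m refl

≢⇒≡ᵇ-false : ∀ m n → m ≢ n → (m ≡ᵇ n) ≡ false
≢⇒≡ᵇ-false m n ne with m ≡ᵇ n in eq
... | true = ⊥-elim (ne (≡ᵇ⇒≡ eq))
... | false = refl

≡ᵇ-sym : ∀ m n → (m ≡ᵇ n) ≡ (n ≡ᵇ m)
≡ᵇ-sym m n = bool-ext (λ p → ≡⇒≡ᵇ n m (sym (≡ᵇ⇒≡ p))) (λ p → ≡⇒≡ᵇ m n (sym (≡ᵇ⇒≡ p)))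

<ᵇ⇒< : ∀ {m n} → (m <ᵇ n) ≡ true → m < n
<ᵇ⇒< {m} {n} p = ℕₚ.<ᵇ⇒< m n (≡true⇒T p)

<⇒<ᵇ : ∀ {m n} → m < n → (m <ᵇ n) ≡ true
<⇒<ᵇ p = T⇒≡true (ℕₚ.<⇒<ᵇ p)

≮⇒<ᵇ-false : ∀ {m n} → ¬ (m < n) → (m <ᵇ n) ≡ false
≮⇒<ᵇ-false {m} {n} ne with m <ᵇ n in eq
... | true = ⊥-elim (ne (<ᵇ⇒< eq))
... | false = refl

≤ᵇ⇒≤ : ∀ {m n} → (m ≤ᵇ n) ≡ true → m ≤ n
≤ᵇ⇒≤ {m} {n} p = ℕₚ.≤ᵇ⇒≤ m n (≡true⇒T p)

any-++ : (f : X → Bool) (xs ys : List X) → any f (xs ++ ys) ≡ any f xs ∨ any f ys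
any-++ f [] ys = refl
any-++ f (x ∷ xs) ys = trans (cong (f x ∨_) (any-++ f xs ys)) (sym (𝔹ₚ.∨-assoc (f x) (any f xs) (any f ys)))

all-++ : (f : X → Bool) (xs ys : List X) → all f (xs ++ ys) ≡ all f xs ∧ all f ys
all-++ f [] ys = refl
all-++ f (x ∷ xs) ys = trans (cong (f x ∧_) (all-++ f xs ys)) (sym (𝔹ₚ.∧-assoc (f x) (all f xs) (all f ys)))

any-cong : (f g : X → Bool) (xs : List X) → (∀ x → x ∈ xs → f x ≡ g x) → any f xs ≡ any g xs
any-cong f g [] h = refl
any-cong f g (x ∷ xs) h = cong₂ _∨_ (h x (here refl)) (any-cong f g xs (λ y m → h y (there m)))

all-cong : (f g : X → Bool) (xs : List X) → (∀ x → x ∈ xs → f x ≡ g x) → all f xs ≡ all g xs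
all-cong f g [] h = refl
all-cong f g (x ∷ xs) h = cong₂ _∧_ (h x (here refl)) (all-cong f g xs (λ y m → h y (there m)))

any⁻ : (f : X → Bool) (xs : List X) → any f xs ≡ true → ∃ λ x → x ∈ xs × f x ≡ true
any⁻ f (x ∷ xs) p with f x in eq
... | true = x , here refl , eq
... | false with any⁻ f xs p
... | y , m , q = y , there m , q

any⁺ : (f : X → Bool) (xs : List X) → ∀ x → x ∈ xs → f x ≡ true → any f xs ≡ true
any⁺ f (y ∷ xs) x (here refl) q = cong (_∨ any f xs) q
any⁺ f (y ∷ xs) x (there m) q = trans (cong (f y ∨_) (any⁺ f xs x m q)) (𝔹ₚ.∨-zeroʳ (f y))

any≡false : (f : X → Bool) (xs : List X) → (∀ x → x ∈ xs → f x ≡ false) → any f xs ≡ false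
any≡false f [] h = refl
any≡false f (x ∷ xs) h = cong₂ _∨_ (h x (here refl)) (any≡false f xs (λ y m → h y (there m)))

all≡false : (f : X → Bool) (xs : List X) → ∀ x → x ∈ xs → f x ≡ false → all f xs ≡ false
all≡false f (y ∷ xs) x (here refl) q = cong (_∧ all f xs) q
all≡false f (y ∷ xs) x (there m) q = trans (cong (f y ∧_) (all≡false f xs x m q)) (𝔹ₚ.∧-zeroʳ (f y))

all⁻ : (f : X → Bool) (xs : List X) → all f xs ≡ true → ∀ x → x ∈ xs → f x ≡ true
all⁻ f (y ∷ xs) p x (here refl) = proj₁ (∧-true⁻ p)
all⁻ f (y ∷ xs) p x (there m) = all⁻ f xs (proj₂ (∧-true⁻ {f y} p)) x m

all≡false⁻ : (f : X → Bool) (xs : List X) → all f xs ≡ false → ∃ λ x → x ∈ xs × f x ≡ false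
all≡false⁻ f (x ∷ xs) p with f x in e
... | false = x , here refl , e
... | true with all≡false⁻ f xs p
... | y , m , q = y , there m , q

any-⊆ : (f : X → Bool) (V V₁ : List X) → (∀ v → v ∈ V₁ → v ∈ V) → (∀ v → v ∈ V → f v ≡ true → v ∈ V₁) →
  any f V ≡ any f V₁
any-⊆ f V V₁ sub closed = bool-ext
  (λ p → let (v , m , q) = any⁻ f V p in any⁺ f V₁ v (closed v m q) q)
  (λ p → let (v , m , q) = any⁻ f V₁ p in any⁺ f V v (sub v m) q)

all-⊆ : (f : X → Bool) (V V₁ : List X) → (∀ v → v ∈ V₁ → v ∈ V) → (∀ v → v ∈ V → f v ≡ false → v ∈ V₁) →
  all f V ≡ all f V₁
all-⊆ f V V₁ sub closed = bool-ext
  (λ p → all≡true V₁ (λ v m → all⁻ f V p v (sub v m)))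
  (λ p → all≡true V (λ v m → holds v m (all⁻ f V₁ p)))
  where
  all≡true : ∀ xs → (∀ x → x ∈ xs → f x ≡ true) → all f xs ≡ true
  all≡true [] h = refl
  all≡true (x ∷ xs) h = cong₂ _∧_ (h x (here refl)) (all≡true xs (λ y m → h y (there m)))
  holds : ∀ v → v ∈ V → (∀ w → w ∈ V₁ → f w ≡ true) → f v ≡ true
  holds v m h with f v in e
  ... | true = refl
  ... | false = trans (sym e) (h v (closed v m e))

any-map : (f : Y → Bool) (g : X → Y) → ∀ xs → any f (map g xs) ≡ any (λ x → f (g x)) xs
any-map f g [] = refl
any-map f g (x ∷ xs) = cong (f (g x) ∨_) (any-map f g xs)

all-map : (f : Y → Bool) (g : X → Y) → ∀ xs → all f (map g xs) ≡ all (λ x → f (g x)) xs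
all-map f g [] = refl
all-map f g (x ∷ xs) = cong (f (g x) ∧_) (all-map f g xs)

any-↭ : (f : X → Bool) {xs ys : List X} → xs ↭ ys → any f xs ≡ any f ys
any-↭ f ↭refl = refl
any-↭ f (prep x p) = cong (f x ∨_) (any-↭ f p)
any-↭ f {xs = _ ∷ _ ∷ xs} {ys = _ ∷ _ ∷ ys} (swap x y p) = begin
  f x ∨ (f y ∨ any f xs)  ≡⟨ cong (λ b → f x ∨ (f y ∨ b)) (any-↭ f p) ⟩
  f x ∨ (f y ∨ any f ys)  ≡⟨ sym (𝔹ₚ.∨-assoc (f x) (f y) _) ⟩
  (f x ∨ f y) ∨ any f ys  ≡⟨ cong (_∨ any f ys) (𝔹ₚ.∨-comm (f x) (f y)) ⟩
  (f y ∨ f x) ∨ any f ys  ≡⟨ 𝔹ₚ.∨-assoc (f y) (f x) _ ⟩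
  f y ∨ (f x ∨ any f ys)  ∎
  where open ≡-Reasoning
any-↭ f (↭trans p q) = trans (any-↭ f p) (any-↭ f q)

all-↭ : (f : X → Bool) {xs ys : List X} → xs ↭ ys → all f xs ≡ all f ys
all-↭ f ↭refl = refl
all-↭ f (prep x p) = cong (f x ∧_) (all-↭ f p)
all-↭ f {xs = _ ∷ _ ∷ xs} {ys = _ ∷ _ ∷ ys} (swap x y p) = begin
  f x ∧ (f y ∧ all f xs)  ≡⟨ cong (λ b → f x ∧ (f y ∧ b)) (all-↭ f p) ⟩
  f x ∧ (f y ∧ all f ys)  ≡⟨ sym (𝔹ₚ.∧-assoc (f x) (f y) _) ⟩
  (f x ∧ f y) ∧ all f ys  ≡⟨ cong (_∧ all f ys) (𝔹ₚ.∧-comm (f x) (f y)) ⟩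
  (f y ∧ f x) ∧ all f ys  ≡⟨ 𝔹ₚ.∧-assoc (f y) (f x) _ ⟩
  f y ∧ (f x ∧ all f ys)  ∎
  where open ≡-Reasoning
all-↭ f (↭trans p q) = trans (all-↭ f p) (all-↭ f q)

count-∷ : (p : X → Bool) → ∀ x xs → count p (x ∷ xs) ≡ (if p x then suc (count p xs) else count p xs)
count-∷ p x xs with p x
... | true = refl
... | false = refl

count-++ : (p : X → Bool) → ∀ xs ys → count p (xs ++ ys) ≡ count p xs + count p ys
count-++ p [] ys = refl
count-++ p (x ∷ xs) ys rewrite count-∷ p x (xs ++ ys) | count-∷ p x xs | count-++ p xs ys with p x
... | true = refl
... | false = refl

count-cong : (f g : X → Bool) → ∀ xs → (∀ x → x ∈ xs → f x ≡ g x) → count f xs ≡ count g xs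
count-cong f g [] h = refl
count-cong f g (x ∷ xs) h
  rewrite count-∷ f x xs | count-∷ g x xs | h x (here refl) | count-cong f g xs (λ y m → h y (there m)) = refl

count≡0 : (f : X → Bool) → ∀ xs → (∀ x → x ∈ xs → f x ≡ false) → count f xs ≡ 0
count≡0 f [] h = refl
count≡0 f (x ∷ xs) h rewrite count-∷ f x xs | h x (here refl) = count≡0 f xs (λ y m → h y (there m))

count≡0⁻ : (f : X → Bool) → ∀ xs → count f xs ≡ 0 → ∀ x → x ∈ xs → f x ≡ false
count≡0⁻ f (y ∷ xs) p x m with f y in e
count≡0⁻ f (y ∷ xs) () x m | true
count≡0⁻ f (y ∷ xs) p x (here refl) | false = e
count≡0⁻ f (y ∷ xs) p x (there m) | false = count≡0⁻ f xs p x m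

count-mono : (f g : X → Bool) → ∀ xs → (∀ x → x ∈ xs → f x ≡ true → g x ≡ true) → count f xs ≤ count g xs
count-mono f g [] h = z≤n
count-mono f g (x ∷ xs) h rewrite count-∷ f x xs | count-∷ g x xs with f x in e₁ | g x in e₂
... | true | true = s≤s (count-mono f g xs (λ y m → h y (there m)))
... | true | false = ⊥-elim (true≢false (trans (sym (h x (here refl) e₁)) e₂))
... | false | true = ℕₚ.m≤n⇒m≤1+n (count-mono f g xs (λ y m → h y (there m)))
... | false | false = count-mono f g xs (λ y m → h y (there m))

count-∨ : (f g : X → Bool) → ∀ xs → (∀ x → x ∈ xs → f x ∧ g x ≡ false) →
  count (λ x → f x ∨ g x) xs ≡ count f xs + count g xs
count-∨ f g [] h = refl
count-∨ f g (x ∷ xs) h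
  rewrite count-∷ (λ x → f x ∨ g x) x xs | count-∷ f x xs | count-∷ g x xs | count-∨ f g xs (λ y m → h y (there m))
  with f x in e₁ | g x in e₂
... | true | true = ⊥-elim (true≢false (trans (sym (cong₂ _∧_ e₁ e₂)) (h x (here refl))))
... | true | false = refl
... | false | true = sym (ℕₚ.+-suc (count f xs) (count g xs))
... | false | false = refl

count-map : (f : Y → Bool) (g : X → Y) → ∀ xs → count f (map g xs) ≡ count (λ x → f (g x)) xs
count-map f g [] = refl
count-map f g (x ∷ xs) rewrite count-∷ f (g x) (map g xs) | count-∷ (λ x → f (g x)) x xs | count-map f g xs = refl

count-↭ : (f : X → Bool) {xs ys : List X} → xs ↭ ys → count f xs ≡ count f ys
count-↭ f ↭refl = refl
count-↭ f {xs = _ ∷ xs} {ys = _ ∷ ys} (prep x p) rewrite count-∷ f x xs | count-∷ f x ys | count-↭ f p = refl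
count-↭ f {xs = _ ∷ _ ∷ xs} {ys = _ ∷ _ ∷ ys} (swap x y p)
  rewrite count-∷ f x (y ∷ xs) | count-∷ f y (x ∷ ys) | count-∷ f y xs | count-∷ f x ys | count-↭ f p
  with f x | f y
... | true | true = refl
... | true | false = refl
... | false | true = refl
... | false | false = refl
count-↭ f (↭trans p q) = trans (count-↭ f p) (count-↭ f q)

∈-filterᵇ⁻ : (P : X → Bool) → ∀ xs {e} → e ∈ filterᵇ P xs → (e ∈ xs) × (P e ≡ true)
∈-filterᵇ⁻ P xs m = let (m′ , pe) = ∈-filter⁻ (λ x → T? (P x)) m in m′ , T⇒≡true pe

filterᵇ-all : (P : X → Bool) → ∀ xs → (∀ x → x ∈ xs → P x ≡ true) → filterᵇ P xs ≡ xs
filterᵇ-all P [] h = refl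
filterᵇ-all P (x ∷ xs) h with P x in eq | h x (here refl)
... | true | _ = cong (x ∷_) (filterᵇ-all P xs (λ y m → h y (there m)))

filterᵇ-accept : (P : X → Bool) → ∀ x xs → P x ≡ true → filterᵇ P (x ∷ xs) ≡ x ∷ filterᵇ P xs
filterᵇ-accept P x xs e with P x
filterᵇ-accept P x xs refl | true = refl

filterᵇ-reject : (P : X → Bool) → ∀ x xs → P x ≡ false → filterᵇ P (x ∷ xs) ≡ filterᵇ P xs
filterᵇ-reject P x xs e with P x
filterᵇ-reject P x xs refl | false = refl

Distinct : List ℕ → Set
Distinct [] = ⊤
Distinct (x ∷ xs) = (x ∉ xs) × Distinct xs

Disjoint : List ℕ → List ℕ → Set
Disjoint V₁ V₂ = ∀ v → v ∈ V₁ → v ∈ V₂ → ⊥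

Distinct-++ˡ : ∀ xs ys → Distinct (xs ++ ys) → Distinct xs
Distinct-++ˡ [] ys u = tt
Distinct-++ˡ (x ∷ xs) ys (x∉ , u) = (λ m → x∉ (∈-++⁺ˡ m)) , Distinct-++ˡ xs ys u

Distinct-++ʳ : ∀ xs ys → Distinct (xs ++ ys) → Distinct ys
Distinct-++ʳ [] ys u = u
Distinct-++ʳ (x ∷ xs) ys (_ , u) = Distinct-++ʳ xs ys u

Distinct-disjoint : ∀ xs ys → Distinct (xs ++ ys) → Disjoint xs ys
Distinct-disjoint (x ∷ xs) ys (x∉ , u) v (here refl) m₂ = x∉ (∈-++⁺ʳ xs m₂)
Distinct-disjoint (x ∷ xs) ys (x∉ , u) v (there m₁) m₂ = Distinct-disjoint xs ys u v m₁ m₂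

Distinct-++ : ∀ xs ys → Distinct xs → Distinct ys → Disjoint xs ys → Distinct (xs ++ ys)
Distinct-++ [] ys ux uy d = uy
Distinct-++ (x ∷ xs) ys (x∉ , ux) uy d =
  (λ m → [ x∉ , d x (here refl) ]′ (∈-++⁻ xs m)) , Distinct-++ xs ys ux uy (λ v m m′ → d v (there m) m′)

Distinct-↭ : ∀ {xs ys} → xs ↭ ys → Distinct xs → Distinct ys
Distinct-↭ ↭refl u = u
Distinct-↭ (prep x p) (x∉ , u) = (λ m → x∉ (↭ₚ.∈-resp-↭ (↭-sym p) m)) , Distinct-↭ p u
Distinct-↭ (swap x y p) (x∉ , y∉ , u) =
  (λ { (here refl) → x∉ (here refl) ; (there m) → y∉ (↭ₚ.∈-resp-↭ (↭-sym p) m) }) ,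
  (λ m → x∉ (there (↭ₚ.∈-resp-↭ (↭-sym p) m))) , Distinct-↭ p u
Distinct-↭ (↭trans p q) u = Distinct-↭ q (Distinct-↭ p u)

memberᵇ : ℕ → List ℕ → Bool
memberᵇ x xs = any (x ≡ᵇ_) xs

memberᵇ-sound : ∀ x xs → memberᵇ x xs ≡ true → x ∈ xs
memberᵇ-sound x xs p with any⁻ _ xs p
... | y , m , q = subst (_∈ xs) (sym (≡ᵇ⇒≡ {x} {y} q)) m

memberᵇ-complete : ∀ x xs → x ∈ xs → memberᵇ x xs ≡ true
memberᵇ-complete x xs m = any⁺ _ xs x m (≡ᵇ-refl x)

distinctᵇ : List ℕ → Bool
distinctᵇ [] = true
distinctᵇ (x ∷ xs) = not (memberᵇ x xs) ∧ distinctᵇ xs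

distinctᵇ-sound : ∀ xs → distinctᵇ xs ≡ true → Distinct xs
distinctᵇ-sound [] _ = tt
distinctᵇ-sound (x ∷ xs) p =
  (λ m → true≢false (trans (sym (memberᵇ-complete x xs m)) (not≡true⁻ (proj₁ (∧-true⁻ p))))) ,
  distinctᵇ-sound xs (proj₂ (∧-true⁻ {not (memberᵇ x xs)} p))

-- Sums over sublists

sumℤ : List ℤ → ℤ
sumℤ = foldr ℤ._+_ ℤ.0ℤ

∑[_]_ : {X : Set} → List X → (X → ℤ) → ℤ
∑[ xs ] f = sumℤ (map f xs)

private
  +-interchange : ∀ a b c d → (a ℤ.+ b) ℤ.+ (c ℤ.+ d) ≡ (a ℤ.+ c) ℤ.+ (b ℤ.+ d)
  +-interchange = solve 4 (λ a b c d → (a :+ b) :+ (c :+ d) := (a :+ c) :+ (b :+ d)) refl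
    where open +-*-Solver

∑-++ : (xs ys : List X) (f : X → ℤ) → ∑[ xs ++ ys ] f ≡ ∑[ xs ] f ℤ.+ ∑[ ys ] f
∑-++ [] ys f = sym (ℤₚ.+-identityˡ _)
∑-++ (x ∷ xs) ys f = trans (cong (ℤ._+_ (f x)) (∑-++ xs ys f)) (sym (ℤₚ.+-assoc (f x) _ _))

∑-map : (xs : List X) (g : X → Y) (f : Y → ℤ) → ∑[ map g xs ] f ≡ ∑[ xs ] (λ x → f (g x))
∑-map [] g f = refl
∑-map (x ∷ xs) g f = cong (ℤ._+_ (f (g x))) (∑-map xs g f)

∑-cong : (xs : List X) (f g : X → ℤ) → (∀ x → x ∈ xs → f x ≡ g x) → ∑[ xs ] f ≡ ∑[ xs ] g
∑-cong [] f g h = refl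
∑-cong (x ∷ xs) f g h = cong₂ ℤ._+_ (h x (here refl)) (∑-cong xs f g (λ y m → h y (there m)))

∑-*ˡ : (xs : List X) (c : ℤ) (f : X → ℤ) → ∑[ xs ] (λ x → c ℤ.* f x) ≡ c ℤ.* ∑[ xs ] f
∑-*ˡ [] c f = sym (ℤₚ.*-zeroʳ c)
∑-*ˡ (x ∷ xs) c f = trans (cong (ℤ._+_ (c ℤ.* f x)) (∑-*ˡ xs c f)) (sym (ℤₚ.*-distribˡ-+ c (f x) _))

∑-*ʳ : (xs : List X) (c : ℤ) (f : X → ℤ) → ∑[ xs ] (λ x → f x ℤ.* c) ≡ ∑[ xs ] f ℤ.* c
∑-*ʳ [] c f = sym (ℤₚ.*-zeroˡ c)
∑-*ʳ (x ∷ xs) c f = trans (cong (ℤ._+_ (f x ℤ.* c)) (∑-*ʳ xs c f)) (sym (ℤₚ.*-distribʳ-+ c (f x) _))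

∑-0 : (xs : List X) (f : X → ℤ) → (∀ x → x ∈ xs → f x ≡ ℤ.0ℤ) → ∑[ xs ] f ≡ ℤ.0ℤ
∑-0 [] f h = refl
∑-0 (x ∷ xs) f h = cong₂ ℤ._+_ (h x (here refl)) (∑-0 xs f (λ y m → h y (there m)))

∑-sublists-∷ : (x : X) (xs : List X) (f : List X → ℤ) →
  ∑[ sublists (x ∷ xs) ] f ≡ ∑[ sublists xs ] f ℤ.+ ∑[ sublists xs ] (λ S → f (x ∷ S))
∑-sublists-∷ x xs f = trans (∑-++ (sublists xs) _ f) (cong (ℤ._+_ (∑[ sublists xs ] f)) (∑-map (sublists xs) (x ∷_) f))

∑-sublists-++ : (xs ys : List X) (f : List X → ℤ) →
  ∑[ sublists (xs ++ ys) ] f ≡ ∑[ sublists xs ] (λ S₁ → ∑[ sublists ys ] (λ S₂ → f (S₁ ++ S₂)))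
∑-sublists-++ [] ys f = sym (ℤₚ.+-identityʳ _)
∑-sublists-++ (x ∷ xs) ys f = begin
  ∑[ sublists (x ∷ xs ++ ys) ] f
    ≡⟨ ∑-sublists-∷ x (xs ++ ys) f ⟩
  ∑[ sublists (xs ++ ys) ] f ℤ.+ ∑[ sublists (xs ++ ys) ] (λ S → f (x ∷ S))
    ≡⟨ cong₂ ℤ._+_ (∑-sublists-++ xs ys f) (∑-sublists-++ xs ys (λ S → f (x ∷ S))) ⟩
  _ ≡⟨ sym (∑-sublists-∷ x xs _) ⟩
  ∑[ sublists (x ∷ xs) ] (λ S₁ → ∑[ sublists ys ] (λ S₂ → f (S₁ ++ S₂))) ∎
  where open ≡-Reasoning

sublists-map : (h : X → Y) (xs : List X) → sublists (map h xs) ≡ map (map h) (sublists xs)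
sublists-map h [] = refl
sublists-map h (x ∷ xs) rewrite sublists-map h xs =
  sym (trans (Listₚ.map-++ (map h) (sublists xs) _) (cong (map (map h) (sublists xs) ++_) (trans (sym (Listₚ.map-∘ (sublists xs))) (Listₚ.map-∘ (sublists xs)))))

sublists-⊆ : (xs : List X) → ∀ S → S ∈ sublists xs → ∀ e → e ∈ S → e ∈ xs
sublists-⊆ [] .[] (here refl) e ()
sublists-⊆ (x ∷ xs) S m e e∈S with ∈-++⁻ (sublists xs) m
... | inj₁ m₁ = there (sublists-⊆ xs S m₁ e e∈S)
... | inj₂ m₂ with ∈-map⁻ (x ∷_) m₂
... | S′ , m₃ , refl with e∈S
... | here refl = here refl
... | there e∈S′ = there (sublists-⊆ xs S′ m₃ e e∈S′)

∑-sublists-filterᵇ : (P : X → Bool) (xs : List X) (f : List X → ℤ) →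
  (∀ S → S ∈ sublists xs → all P S ≡ false → f S ≡ ℤ.0ℤ) →
  ∑[ sublists xs ] f ≡ ∑[ sublists (filterᵇ P xs) ] f
∑-sublists-filterᵇ P [] f h = refl
∑-sublists-filterᵇ P (x ∷ xs) f h with P x in e
... | true = trans (∑-sublists-∷ x xs f) (trans (cong₂ ℤ._+_
        (∑-sublists-filterᵇ P xs f (λ S m q → h S (∈-++⁺ˡ m) q))
        (∑-sublists-filterᵇ P xs (λ S → f (x ∷ S))
          (λ S m q → h (x ∷ S) (∈-++⁺ʳ (sublists xs) (∈-map⁺ (x ∷_) m)) (trans (cong (_∧ all P S) e) q))))
        (sym (∑-sublists-∷ x (filterᵇ P xs) f)))
... | false = trans (∑-sublists-∷ x xs f) (trans (cong₂ ℤ._+_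
        (∑-sublists-filterᵇ P xs f (λ S m q → h S (∈-++⁺ˡ m) q))
        (∑-0 (sublists xs) _ (λ S m → h (x ∷ S) (∈-++⁺ʳ (sublists xs) (∈-map⁺ (x ∷_) m)) (cong (_∧ all P S) e))))
        (ℤₚ.+-identityʳ _))

∑-sublists-↭ : {xs ys : List X} → xs ↭ ys → (f : List X → ℤ) → (∀ {S S′} → S ↭ S′ → f S ≡ f S′) →
  ∑[ sublists xs ] f ≡ ∑[ sublists ys ] f
∑-sublists-↭ ↭refl f inv = refl
∑-sublists-↭ {xs = x ∷ xs} {x ∷ ys} (prep x p) f inv =
  trans (∑-sublists-∷ x xs f)
    (trans (cong₂ ℤ._+_ (∑-sublists-↭ p f inv) (∑-sublists-↭ p (λ S → f (x ∷ S)) (λ q → inv (prep x q))))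
      (sym (∑-sublists-∷ x ys f)))
∑-sublists-↭ {xs = x ∷ y ∷ xs} {y ∷ x ∷ ys} (swap x y p) f inv = begin
  ∑[ sublists (x ∷ y ∷ xs) ] f
    ≡⟨ expand x y xs ⟩
  (∑[ sublists xs ] f ℤ.+ ∑[ sublists xs ] (λ S → f (y ∷ S))) ℤ.+
    (∑[ sublists xs ] (λ S → f (x ∷ S)) ℤ.+ ∑[ sublists xs ] (λ S → f (x ∷ y ∷ S)))
    ≡⟨ cong₂ ℤ._+_ (cong₂ ℤ._+_ (∑-sublists-↭ p f inv) (∑-sublists-↭ p (λ S → f (y ∷ S)) (λ q → inv (prep y q))))
                   (cong₂ ℤ._+_ (∑-sublists-↭ p (λ S → f (x ∷ S)) (λ q → inv (prep x q)))
                                (∑-sublists-↭ p (λ S → f (x ∷ y ∷ S)) (λ q → inv (prep x (prep y q))))) ⟩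
  (∑[ sublists ys ] f ℤ.+ ∑[ sublists ys ] (λ S → f (y ∷ S))) ℤ.+
    (∑[ sublists ys ] (λ S → f (x ∷ S)) ℤ.+ ∑[ sublists ys ] (λ S → f (x ∷ y ∷ S)))
    ≡⟨ +-interchange (∑[ sublists ys ] f) (∑[ sublists ys ] (λ S → f (y ∷ S))) (∑[ sublists ys ] (λ S → f (x ∷ S))) _ ⟩
  (∑[ sublists ys ] f ℤ.+ ∑[ sublists ys ] (λ S → f (x ∷ S))) ℤ.+
    (∑[ sublists ys ] (λ S → f (y ∷ S)) ℤ.+ ∑[ sublists ys ] (λ S → f (x ∷ y ∷ S)))
    ≡⟨ cong (λ z → (∑[ sublists ys ] f ℤ.+ ∑[ sublists ys ] (λ S → f (x ∷ S))) ℤ.+ (∑[ sublists ys ] (λ S → f (y ∷ S)) ℤ.+ z))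
            (∑-cong (sublists ys) _ _ (λ S _ → inv (swap x y ↭refl))) ⟩
  (∑[ sublists ys ] f ℤ.+ ∑[ sublists ys ] (λ S → f (x ∷ S))) ℤ.+
    (∑[ sublists ys ] (λ S → f (y ∷ S)) ℤ.+ ∑[ sublists ys ] (λ S → f (y ∷ x ∷ S)))
    ≡⟨ sym (expand y x ys) ⟩
  ∑[ sublists (y ∷ x ∷ ys) ] f ∎
  where
  open ≡-Reasoning
  expand : ∀ a b zs → ∑[ sublists (a ∷ b ∷ zs) ] f ≡
    (∑[ sublists zs ] f ℤ.+ ∑[ sublists zs ] (λ S → f (b ∷ S))) ℤ.+
      (∑[ sublists zs ] (λ S → f (a ∷ S)) ℤ.+ ∑[ sublists zs ] (λ S → f (a ∷ b ∷ S)))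
  expand a b zs = trans (∑-sublists-∷ a (b ∷ zs) f) (cong₂ ℤ._+_ (∑-sublists-∷ b zs f) (∑-sublists-∷ b zs (λ S → f (a ∷ S))))
∑-sublists-↭ (↭trans p q) f inv = trans (∑-sublists-↭ p f inv) (∑-sublists-↭ q f inv)

-- Weights of spanning subgraphs

-- The component statistics of Defs for an arbitrary vertex list V, adjacency A and connectivity C;
-- the summand of Defs.qG is `weight` for V = upTo n, A = adj n S and C = reachableIn n S n.
module Components (V : List ℕ) (A : ℕ → ℕ → Bool) (C : ℕ → ℕ → Bool) where
  degree : ℕ → ℕ
  degree u = count (A u) V

  componentSize : ℕ → ℕ
  componentSize u = count (C u) V

  isEdgeComponent : ℕ → Bool
  isEdgeComponent u = componentSize u ≡ᵇ 2

  isCycleComponent : ℕ → Bool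
  isCycleComponent u = (3 ≤ᵇ componentSize u) ∧ all (λ w → not (C u w) ∨ (degree w ≡ᵇ 2)) V

  elementary : Bool
  elementary = all (λ u → isEdgeComponent u ∨ isCycleComponent u) V

  isRepresentative : ℕ → Bool
  isRepresentative u = not (any (λ w → (w <ᵇ u) ∧ C u w) V)

  #edgeComponents #cycleComponents : ℕ
  #edgeComponents = count (λ u → isRepresentative u ∧ isEdgeComponent u) V
  #cycleComponents = count (λ u → isRepresentative u ∧ isCycleComponent u) V

  sign : ℤ
  sign = (ℤ.- ℤ.1ℤ) ℤ.^ #edgeComponents ℤ.* (ℤ.- (+ 2)) ℤ.^ #cycleComponents

  weight : ℤ
  weight = if elementary then sign else ℤ.0ℤ

reachable : List ℕ → (ℕ → ℕ → Bool) → ℕ → ℕ → ℕ → Bool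
reachable V A zero u w = u ≡ᵇ w
reachable V A (suc s) u w = reachable V A s u w ∨ any (λ v → reachable V A s u v ∧ A v w) V

wt : List ℕ → ℕ → (ℕ → ℕ → Bool) → ℤ
wt V s A = Components.weight V A (reachable V A s)

-- Defs.adj ignores its vertex-count argument.
adjOf : List (ℕ × ℕ) → ℕ → ℕ → Bool
adjOf = adj 0

-- Connectivity is decided by walks of length ≤ s, which is exact once s is at least the number of vertices.
qList : List ℕ → ℕ → List (ℕ × ℕ) → ℤ
qList V s E = ∑[ sublists E ] (λ S → wt V s (adjOf S))

reachableIn≡reachable : ∀ n E s u w → reachableIn n E s u w ≡ reachable (upTo n) (adjOf E) s u w
reachableIn≡reachable n E zero u w = refl
reachableIn≡reachable n E (suc s) u w = cong₂ _∨_ (reachableIn≡reachable n E s u w)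
  (any-cong _ _ (upTo n) (λ v _ → cong (_∧ adj n E v w) (reachableIn≡reachable n E s u v)))

module _ (V : List ℕ) (A C : ℕ → ℕ → Bool) (V′ : List ℕ) (A′ C′ : ℕ → ℕ → Bool) where
  private
    module G = Components V A C
    module G′ = Components V′ A′ C′

  weight-≡ : G.elementary ≡ G′.elementary → G.#edgeComponents ≡ G′.#edgeComponents →
    G.#cycleComponents ≡ G′.#cycleComponents → G.weight ≡ G′.weight
  weight-≡ el ne nc = cong₂ (λ e b → if e then b else ℤ.0ℤ) el
    (cong₂ (λ a b → (ℤ.- ℤ.1ℤ) ℤ.^ a ℤ.* (ℤ.- (+ 2)) ℤ.^ b) ne nc)

module _ (V : List ℕ) (A A′ C C′ : ℕ → ℕ → Bool)
         (A≡ : ∀ u v → u ∈ V → v ∈ V → A u v ≡ A′ u v)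
         (C≡ : ∀ u v → u ∈ V → v ∈ V → C u v ≡ C′ u v) where
  private
    module G = Components V A C
    module G′ = Components V A′ C′
    componentSize≡ : ∀ u → u ∈ V → G.componentSize u ≡ G′.componentSize u
    componentSize≡ u m = count-cong _ _ V (λ v m′ → C≡ u v m m′)
    isEdgeComponent≡ : ∀ u → u ∈ V → G.isEdgeComponent u ≡ G′.isEdgeComponent u
    isEdgeComponent≡ u m = cong (_≡ᵇ 2) (componentSize≡ u m)
    isCycleComponent≡ : ∀ u → u ∈ V → G.isCycleComponent u ≡ G′.isCycleComponent u
    isCycleComponent≡ u m = cong₂ _∧_ (cong (3 ≤ᵇ_) (componentSize≡ u m))
      (all-cong _ _ V (λ w m′ → cong₂ _∨_ (cong not (C≡ u w m m′))
        (cong (_≡ᵇ 2) (count-cong _ _ V (λ v m″ → A≡ w v m′ m″)))))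
    isRepresentative≡ : ∀ u → u ∈ V → G.isRepresentative u ≡ G′.isRepresentative u
    isRepresentative≡ u m = cong not (any-cong _ _ V (λ w m′ → cong ((w <ᵇ u) ∧_) (C≡ u w m m′)))

  weight-cong : G.weight ≡ G′.weight
  weight-cong = weight-≡ V A C V A′ C′
    (all-cong _ _ V (λ u m → cong₂ _∨_ (isEdgeComponent≡ u m) (isCycleComponent≡ u m)))
    (count-cong _ _ V (λ u m → cong₂ _∧_ (isRepresentative≡ u m) (isEdgeComponent≡ u m)))
    (count-cong _ _ V (λ u m → cong₂ _∧_ (isRepresentative≡ u m) (isCycleComponent≡ u m)))

reachable-cong : ∀ V (A A′ : ℕ → ℕ → Bool) → (∀ u v → u ∈ V → v ∈ V → A u v ≡ A′ u v) →
  ∀ s u w → w ∈ V → reachable V A s u w ≡ reachable V A′ s u w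
reachable-cong V A A′ h zero u w m = refl
reachable-cong V A A′ h (suc s) u w m = cong₂ _∨_ (reachable-cong V A A′ h s u w m)
  (any-cong _ _ V (λ v m′ → cong₂ _∧_ (reachable-cong V A A′ h s u v m′) (h v w m′ m)))

wt-cong : ∀ V s (A A′ : ℕ → ℕ → Bool) → (∀ u v → u ∈ V → v ∈ V → A u v ≡ A′ u v) → wt V s A ≡ wt V s A′
wt-cong V s A A′ h = weight-cong V A A′ _ _ h (λ u v _ m → reachable-cong V A A′ h s u v m)

q≡qList : ∀ n E → qG (graph n E) ≡ qList (upTo n) n E
q≡qList n E = ∑-cong (sublists E) _ _ (λ S _ →
  weight-cong (upTo n) (adj n S) (adjOf S) _ _ (λ _ _ _ _ → refl) (λ u v _ _ → reachableIn≡reachable n S n u v))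

module _ {V V′ : List ℕ} (p : V ↭ V′) (A C : ℕ → ℕ → Bool) where
  private
    module G = Components V A C
    module G′ = Components V′ A C
    isEdgeComponent≡ : ∀ u → G.isEdgeComponent u ≡ G′.isEdgeComponent u
    isEdgeComponent≡ u = cong (_≡ᵇ 2) (count-↭ _ p)
    isCycleComponent≡ : ∀ u → G.isCycleComponent u ≡ G′.isCycleComponent u
    isCycleComponent≡ u = cong₂ _∧_ (cong (3 ≤ᵇ_) (count-↭ _ p))
      (trans (all-cong _ _ V (λ w _ → cong (λ d → not (C u w) ∨ (d ≡ᵇ 2)) (count-↭ _ p))) (all-↭ _ p))
    isRepresentative≡ : ∀ u → G.isRepresentative u ≡ G′.isRepresentative u
    isRepresentative≡ u = cong not (any-↭ _ p)

  weight-↭ : G.weight ≡ G′.weight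
  weight-↭ = weight-≡ V A C V′ A C
    (trans (all-cong _ _ V (λ u _ → cong₂ _∨_ (isEdgeComponent≡ u) (isCycleComponent≡ u))) (all-↭ _ p))
    (trans (count-cong _ _ V (λ u _ → cong₂ _∧_ (isRepresentative≡ u) (isEdgeComponent≡ u))) (count-↭ _ p))
    (trans (count-cong _ _ V (λ u _ → cong₂ _∧_ (isRepresentative≡ u) (isCycleComponent≡ u))) (count-↭ _ p))

reachable-↭ : ∀ {V V′} → V ↭ V′ → ∀ A s u w → reachable V A s u w ≡ reachable V′ A s u w
reachable-↭ p A zero u w = refl
reachable-↭ {V} p A (suc s) u w = cong₂ _∨_ (reachable-↭ p A s u w)
  (trans (any-cong _ _ V (λ v _ → cong (_∧ A v w) (reachable-↭ p A s u v))) (any-↭ _ p))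

wt-↭ : ∀ {V V′} → V ↭ V′ → ∀ s A → wt V s A ≡ wt V′ s A
wt-↭ {V} p s A = trans (weight-cong V A A _ _ (λ _ _ _ _ → refl) (λ u v _ _ → reachable-↭ p A s u v)) (weight-↭ p A _)

record OrderEmbeddingOn (V : List ℕ) (ℓ : ℕ → ℕ) : Set where
  field
    ≡ᵇ-pres : ∀ u v → u ∈ V → v ∈ V → (ℓ u ≡ᵇ ℓ v) ≡ (u ≡ᵇ v)
    <ᵇ-pres : ∀ u v → u ∈ V → v ∈ V → (ℓ u <ᵇ ℓ v) ≡ (u <ᵇ v)

  injective : ∀ u v → u ∈ V → v ∈ V → ℓ u ≡ ℓ v → u ≡ v
  injective u v mu mv e = ≡ᵇ⇒≡ (trans (sym (≡ᵇ-pres u v mu mv)) (≡⇒≡ᵇ _ _ e))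

open OrderEmbeddingOn

OrderEmbeddingOn-⊆ : ∀ {V W ℓ} → (∀ v → v ∈ W → v ∈ V) → OrderEmbeddingOn V ℓ → OrderEmbeddingOn W ℓ
OrderEmbeddingOn-⊆ W⊆V emb = record
  { ≡ᵇ-pres = λ u v mu mv → ≡ᵇ-pres emb u v (W⊆V u mu) (W⊆V v mv)
  ; <ᵇ-pres = λ u v mu mv → <ᵇ-pres emb u v (W⊆V u mu) (W⊆V v mv)
  }

module _ (V : List ℕ) (ℓ : ℕ → ℕ) (emb : OrderEmbeddingOn V ℓ) (A A′ C C′ : ℕ → ℕ → Bool)
         (A≡ : ∀ u v → u ∈ V → v ∈ V → A′ (ℓ u) (ℓ v) ≡ A u v)
         (C≡ : ∀ u v → u ∈ V → v ∈ V → C′ (ℓ u) (ℓ v) ≡ C u v) where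
  private
    module G = Components V A C
    module G′ = Components (map ℓ V) A′ C′
    degree≡ : ∀ u → u ∈ V → G′.degree (ℓ u) ≡ G.degree u
    degree≡ u m = trans (count-map _ ℓ V) (count-cong _ _ V (λ v m′ → A≡ u v m m′))
    componentSize≡ : ∀ u → u ∈ V → G′.componentSize (ℓ u) ≡ G.componentSize u
    componentSize≡ u m = trans (count-map _ ℓ V) (count-cong _ _ V (λ v m′ → C≡ u v m m′))
    isEdgeComponent≡ : ∀ u → u ∈ V → G′.isEdgeComponent (ℓ u) ≡ G.isEdgeComponent u
    isEdgeComponent≡ u m = cong (_≡ᵇ 2) (componentSize≡ u m)
    isCycleComponent≡ : ∀ u → u ∈ V → G′.isCycleComponent (ℓ u) ≡ G.isCycleComponent u
    isCycleComponent≡ u m = cong₂ _∧_ (cong (3 ≤ᵇ_) (componentSize≡ u m))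
      (trans (all-map _ ℓ V) (all-cong _ _ V (λ w m′ → cong₂ _∨_ (cong not (C≡ u w m m′)) (cong (_≡ᵇ 2) (degree≡ w m′)))))
    isRepresentative≡ : ∀ u → u ∈ V → G′.isRepresentative (ℓ u) ≡ G.isRepresentative u
    isRepresentative≡ u m = cong not (trans (any-map _ ℓ V)
      (any-cong _ _ V (λ w m′ → cong₂ _∧_ (<ᵇ-pres emb w u m′ m) (C≡ u w m m′))))

  weight-relabel : G′.weight ≡ G.weight
  weight-relabel = weight-≡ (map ℓ V) A′ C′ V A C
    (trans (all-map _ ℓ V) (all-cong _ _ V (λ u m → cong₂ _∨_ (isEdgeComponent≡ u m) (isCycleComponent≡ u m))))
    (trans (count-map _ ℓ V) (count-cong _ _ V (λ u m → cong₂ _∧_ (isRepresentative≡ u m) (isEdgeComponent≡ u m))))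
    (trans (count-map _ ℓ V) (count-cong _ _ V (λ u m → cong₂ _∧_ (isRepresentative≡ u m) (isCycleComponent≡ u m))))

reachable-relabel : ∀ V (ℓ : ℕ → ℕ) → OrderEmbeddingOn V ℓ → (A A′ : ℕ → ℕ → Bool) →
  (∀ u v → u ∈ V → v ∈ V → A′ (ℓ u) (ℓ v) ≡ A u v) →
  ∀ s u w → u ∈ V → w ∈ V → reachable (map ℓ V) A′ s (ℓ u) (ℓ w) ≡ reachable V A s u w
reachable-relabel V ℓ emb A A′ A≡ zero u w mu mw = ≡ᵇ-pres emb u w mu mw
reachable-relabel V ℓ emb A A′ A≡ (suc s) u w mu mw = cong₂ _∨_ (reachable-relabel V ℓ emb A A′ A≡ s u w mu mw)
  (trans (any-map _ ℓ V) (any-cong _ _ V (λ v m → cong₂ _∧_ (reachable-relabel V ℓ emb A A′ A≡ s u v mu m) (A≡ v w m mw))))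

wt-relabel : ∀ V (ℓ : ℕ → ℕ) → OrderEmbeddingOn V ℓ → ∀ s (A A′ : ℕ → ℕ → Bool) →
  (∀ u v → u ∈ V → v ∈ V → A′ (ℓ u) (ℓ v) ≡ A u v) → wt (map ℓ V) s A′ ≡ wt V s A
wt-relabel V ℓ emb s A A′ A≡ =
  weight-relabel V ℓ emb A A′ _ _ A≡ (λ u v mu mv → reachable-relabel V ℓ emb A A′ A≡ s u v mu mv)

Stable : List ℕ → (ℕ → ℕ → Bool) → ℕ → Set
Stable V A t = ∀ u w → u ∈ V → w ∈ V → reachable V A (suc t) u w ≡ reachable V A t u w

reachable-stable : ∀ V A t → Stable V A t → ∀ j u w → u ∈ V → w ∈ V → reachable V A (j + t) u w ≡ reachable V A t u w
reachable-stable V A t st zero u w mu mw = refl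
reachable-stable V A t st (suc j) u w mu mw = trans (cong₂ _∨_ (reachable-stable V A t st j u w mu mw)
  (any-cong _ _ V (λ v m → cong (_∧ A v w) (reachable-stable V A t st j u v mu m)))) (st u w mu mw)

wt-stable : ∀ V A t → Stable V A t → ∀ j → wt V (j + t) A ≡ wt V t A
wt-stable V A t st j = weight-cong V A A _ _ (λ _ _ _ _ → refl) (reachable-stable V A t st j)

module Restriction (V : List ℕ) (A : ℕ → ℕ → Bool) (s : ℕ) (V₁ : List ℕ) (A₁ : ℕ → ℕ → Bool)
  (V₁⊆V : ∀ v → v ∈ V₁ → v ∈ V)
  (agree : ∀ u v → u ∈ V₁ → A u v ≡ A₁ u v)
  (closed : ∀ u v → u ∈ V₁ → A₁ u v ≡ true → v ∈ V₁)
  (count≡ : ∀ (p : ℕ → Bool) → (∀ v → v ∈ V → p v ≡ true → v ∈ V₁) → count p V ≡ count p V₁) where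

  reachable-closed : ∀ t u w → u ∈ V₁ → reachable V₁ A₁ t u w ≡ true → w ∈ V₁
  reachable-closed zero u w m p = subst (_∈ V₁) (≡ᵇ⇒≡ {u} {w} p) m
  reachable-closed (suc t) u w m p with ∨-true⁻ {reachable V₁ A₁ t u w} p
  ... | inj₁ q = reachable-closed t u w m q
  ... | inj₂ q with any⁻ _ V₁ q
  ... | v , _ , r = closed v w (reachable-closed t u v m (proj₁ (∧-true⁻ r))) (proj₂ (∧-true⁻ {reachable V₁ A₁ t u v} r))

  reachable-restrict : ∀ t u w → u ∈ V₁ → reachable V A t u w ≡ reachable V₁ A₁ t u w
  reachable-restrict zero u w m = refl
  reachable-restrict (suc t) u w m = cong₂ _∨_ (reachable-restrict t u w m)
    (trans (any-cong _ step V (λ v _ → step≡ v))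
      (any-⊆ step V V₁ V₁⊆V (λ v _ q → reachable-closed t u v m (proj₁ (∧-true⁻ q)))))
    where
    step : ℕ → Bool
    step v = reachable V₁ A₁ t u v ∧ A₁ v w
    step≡ : ∀ v → (reachable V A t u v ∧ A v w) ≡ step v
    step≡ v rewrite reachable-restrict t u v m with reachable V₁ A₁ t u v in e
    ... | true = agree v w (reachable-closed t u v m e)
    ... | false = refl

  private
    module G = Components V A (reachable V A s)
    module G₁ = Components V₁ A₁ (reachable V₁ A₁ s)

    degree≡ : ∀ u → u ∈ V₁ → G.degree u ≡ G₁.degree u
    degree≡ u m = trans (count-cong _ _ V (λ v _ → agree u v m)) (count≡ _ (λ v _ q → closed u v m q))

    componentSize≡ : ∀ u → u ∈ V₁ → G.componentSize u ≡ G₁.componentSize u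
    componentSize≡ u m = trans (count-cong _ _ V (λ v _ → reachable-restrict s u v m))
      (count≡ _ (λ v _ q → reachable-closed s u v m q))

  isEdgeComponent≡ : ∀ u → u ∈ V₁ → G.isEdgeComponent u ≡ G₁.isEdgeComponent u
  isEdgeComponent≡ u m = cong (_≡ᵇ 2) (componentSize≡ u m)

  isCycleComponent≡ : ∀ u → u ∈ V₁ → G.isCycleComponent u ≡ G₁.isCycleComponent u
  isCycleComponent≡ u m = cong₂ _∧_ (cong (3 ≤ᵇ_) (componentSize≡ u m))
    (trans (all-cong _ regular V regular≡) (all-⊆ regular V V₁ V₁⊆V (λ v _ q → reachable-closed s u v m (reached v q))))
    where
    regular : ℕ → Bool
    regular w = not (reachable V₁ A₁ s u w) ∨ (G₁.degree w ≡ᵇ 2)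
    reached : ∀ v → regular v ≡ false → reachable V₁ A₁ s u v ≡ true
    reached v q with reachable V₁ A₁ s u v
    ... | true = refl
    ... | false = sym q
    regular≡ : ∀ w → w ∈ V → (not (reachable V A s u w) ∨ (G.degree w ≡ᵇ 2)) ≡ regular w
    regular≡ w _ rewrite reachable-restrict s u w m with reachable V₁ A₁ s u w in e
    ... | true = cong (_≡ᵇ 2) (degree≡ w (reachable-closed s u w m e))
    ... | false = refl

  isRepresentative≡ : ∀ u → u ∈ V₁ → G.isRepresentative u ≡ G₁.isRepresentative u
  isRepresentative≡ u m = cong not (trans (any-cong _ _ V (λ w _ → cong ((w <ᵇ u) ∧_) (reachable-restrict s u w m)))
    (any-⊆ _ V V₁ V₁⊆V (λ v _ q → reachable-closed s u v m (proj₂ (∧-true⁻ {v <ᵇ u} q)))))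

Supported : (ℕ → ℕ → Bool) → List ℕ → Set
Supported A V = ∀ u v → A u v ≡ true → (u ∈ V) × (v ∈ V)

sign-+ : ∀ a₁ a₂ b₁ b₂ → (ℤ.- ℤ.1ℤ) ℤ.^ (a₁ + a₂) ℤ.* (ℤ.- (+ 2)) ℤ.^ (b₁ + b₂) ≡
  ((ℤ.- ℤ.1ℤ) ℤ.^ a₁ ℤ.* (ℤ.- (+ 2)) ℤ.^ b₁) ℤ.* ((ℤ.- ℤ.1ℤ) ℤ.^ a₂ ℤ.* (ℤ.- (+ 2)) ℤ.^ b₂)
sign-+ a₁ a₂ b₁ b₂ rewrite ℤₚ.^-distribˡ-+-* (ℤ.- ℤ.1ℤ) a₁ a₂ | ℤₚ.^-distribˡ-+-* (ℤ.- (+ 2)) b₁ b₂ =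
  interchange ((ℤ.- ℤ.1ℤ) ℤ.^ a₁) ((ℤ.- ℤ.1ℤ) ℤ.^ a₂) ((ℤ.- (+ 2)) ℤ.^ b₁) ((ℤ.- (+ 2)) ℤ.^ b₂)
  where
  open +-*-Solver
  interchange : ∀ x₁ x₂ y₁ y₂ → (x₁ ℤ.* x₂) ℤ.* (y₁ ℤ.* y₂) ≡ (x₁ ℤ.* y₁) ℤ.* (x₂ ℤ.* y₂)
  interchange = solve 4 (λ x₁ x₂ y₁ y₂ → (x₁ :* x₂) :* (y₁ :* y₂) := (x₁ :* y₁) :* (x₂ :* y₂)) refl

count-++-supportˡ : ∀ V₁ V₂ → Disjoint V₁ V₂ → ∀ (p : ℕ → Bool) → (∀ v → v ∈ V₁ ++ V₂ → p v ≡ true → v ∈ V₁) →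
  count p (V₁ ++ V₂) ≡ count p V₁
count-++-supportˡ V₁ V₂ disj p supp = trans (count-++ p V₁ V₂) (trans (cong (_+_ (count p V₁)) (count≡0 p V₂ outside)) (ℕₚ.+-identityʳ _))
  where
  outside : ∀ v → v ∈ V₂ → p v ≡ false
  outside v m with p v in e
  ... | true = ⊥-elim (disj v (supp v (∈-++⁺ʳ V₁ m) e) m)
  ... | false = refl

count-++-supportʳ : ∀ V₁ V₂ → Disjoint V₁ V₂ → ∀ (p : ℕ → Bool) → (∀ v → v ∈ V₁ ++ V₂ → p v ≡ true → v ∈ V₂) →
  count p (V₁ ++ V₂) ≡ count p V₂
count-++-supportʳ V₁ V₂ disj p supp = trans (count-++ p V₁ V₂) (cong (_+ count p V₂) (count≡0 p V₁ outside))
  where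
  outside : ∀ v → v ∈ V₁ → p v ≡ false
  outside v m with p v in e
  ... | true = ⊥-elim (disj v m (supp v (∈-++⁺ˡ m) e))
  ... | false = refl

wt-⊎ : ∀ V₁ V₂ s (A₁ A₂ : ℕ → ℕ → Bool) → Supported A₁ V₁ → Supported A₂ V₂ → Disjoint V₁ V₂ →
  wt (V₁ ++ V₂) s (λ u v → A₁ u v ∨ A₂ u v) ≡ wt V₁ s A₁ ℤ.* wt V₂ s A₂
wt-⊎ V₁ V₂ s A₁ A₂ supp₁ supp₂ disj = weight≡
  where
  V = V₁ ++ V₂
  A : ℕ → ℕ → Bool
  A u v = A₁ u v ∨ A₂ u v
  off : ∀ {W₁ W₂} (B : ℕ → ℕ → Bool) → Supported B W₂ → Disjoint W₁ W₂ → ∀ u v → u ∈ W₁ → B u v ≡ false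
  off B supp d u v m with B u v in e
  ... | true = ⊥-elim (d u m (proj₁ (supp u v e)))
  ... | false = refl
  module R₁ = Restriction V A s V₁ A₁ (λ v m → ∈-++⁺ˡ m)
    (λ u v m → trans (cong (A₁ u v ∨_) (off A₂ supp₂ disj u v m)) (𝔹ₚ.∨-identityʳ _))
    (λ u v m q → proj₂ (supp₁ u v q)) (count-++-supportˡ V₁ V₂ disj)
  module R₂ = Restriction V A s V₂ A₂ (λ v m → ∈-++⁺ʳ V₁ m)
    (λ u v m → cong (_∨ A₂ u v) (off A₁ supp₁ (λ v m₁ m₂ → disj v m₂ m₁) u v m))
    (λ u v m q → proj₂ (supp₂ u v q)) (count-++-supportʳ V₁ V₂ disj)
  module G = Components V A (reachable V A s)
  module G₁ = Components V₁ A₁ (reachable V₁ A₁ s)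
  module G₂ = Components V₂ A₂ (reachable V₂ A₂ s)
  elementary≡ : G.elementary ≡ G₁.elementary ∧ G₂.elementary
  elementary≡ = trans (all-++ _ V₁ V₂) (cong₂ _∧_
    (all-cong _ _ V₁ (λ u m → cong₂ _∨_ (R₁.isEdgeComponent≡ u m) (R₁.isCycleComponent≡ u m)))
    (all-cong _ _ V₂ (λ u m → cong₂ _∨_ (R₂.isEdgeComponent≡ u m) (R₂.isCycleComponent≡ u m))))
  #edge≡ : G.#edgeComponents ≡ G₁.#edgeComponents + G₂.#edgeComponents
  #edge≡ = trans (count-++ _ V₁ V₂) (cong₂ _+_
    (count-cong _ _ V₁ (λ u m → cong₂ _∧_ (R₁.isRepresentative≡ u m) (R₁.isEdgeComponent≡ u m)))
    (count-cong _ _ V₂ (λ u m → cong₂ _∧_ (R₂.isRepresentative≡ u m) (R₂.isEdgeComponent≡ u m))))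
  #cycle≡ : G.#cycleComponents ≡ G₁.#cycleComponents + G₂.#cycleComponents
  #cycle≡ = trans (count-++ _ V₁ V₂) (cong₂ _+_
    (count-cong _ _ V₁ (λ u m → cong₂ _∧_ (R₁.isRepresentative≡ u m) (R₁.isCycleComponent≡ u m)))
    (count-cong _ _ V₂ (λ u m → cong₂ _∧_ (R₂.isRepresentative≡ u m) (R₂.isCycleComponent≡ u m))))
  weight≡ : G.weight ≡ G₁.weight ℤ.* G₂.weight
  weight≡ rewrite elementary≡ | #edge≡ | #cycle≡ | sign-+ G₁.#edgeComponents G₂.#edgeComponents G₁.#cycleComponents G₂.#cycleComponents
    with G₁.elementary | G₂.elementary
  ... | true | true = refl
  ... | true | false = sym (ℤₚ.*-zeroʳ G₁.sign)
  ... | false | true = refl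
  ... | false | false = refl

adjOf-++ : ∀ S₁ S₂ u v → adjOf (S₁ ++ S₂) u v ≡ adjOf S₁ u v ∨ adjOf S₂ u v
adjOf-++ S₁ S₂ u v = any-++ _ S₁ S₂

adjOf-↭ : ∀ {S S′} → S ↭ S′ → ∀ u v → adjOf S u v ≡ adjOf S′ u v
adjOf-↭ p u v = any-↭ _ p

adjOf⁻ : ∀ S u v → adjOf S u v ≡ true → ∃ λ a → ∃ λ b → ((a , b) ∈ S) × ((u ≡ a × v ≡ b) ⊎ (u ≡ b × v ≡ a))
adjOf⁻ S u v p with any⁻ _ S p
... | (a , b) , m , q with ∨-true⁻ {(u ≡ᵇ a) ∧ (v ≡ᵇ b)} q
... | inj₁ r = a , b , m , inj₁ (≡ᵇ⇒≡ (proj₁ (∧-true⁻ r)) , ≡ᵇ⇒≡ (proj₂ (∧-true⁻ {u ≡ᵇ a} r)))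
... | inj₂ r = a , b , m , inj₂ (≡ᵇ⇒≡ (proj₁ (∧-true⁻ r)) , ≡ᵇ⇒≡ (proj₂ (∧-true⁻ {u ≡ᵇ b} r)))

adjOf⁺ : ∀ S a b → (a , b) ∈ S → adjOf S a b ≡ true
adjOf⁺ S a b m = any⁺ _ S (a , b) m (cong (_∨ ((a ≡ᵇ b) ∧ (b ≡ᵇ a))) (cong₂ _∧_ (≡ᵇ-refl a) (≡ᵇ-refl b)))

adjOf⁺′ : ∀ S a b → (a , b) ∈ S → adjOf S b a ≡ true
adjOf⁺′ S a b m = any⁺ _ S (a , b) m
  (trans (cong (((b ≡ᵇ a) ∧ (a ≡ᵇ b)) ∨_) (cong₂ _∧_ (≡ᵇ-refl b) (≡ᵇ-refl a))) (𝔹ₚ.∨-zeroʳ _))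

reachable-refl : ∀ V A s u → reachable V A s u u ≡ true
reachable-refl V A zero u = ≡ᵇ-refl u
reachable-refl V A (suc s) u rewrite reachable-refl V A s u = refl

reachable-+ : ∀ V A j s u w → reachable V A s u w ≡ true → reachable V A (j + s) u w ≡ true
reachable-+ V A zero s u w p = p
reachable-+ V A (suc j) s u w p rewrite reachable-+ V A j s u w p = refl

reachable-mono : ∀ V A {s s′} u w → s ≤ s′ → reachable V A s u w ≡ true → reachable V A s′ u w ≡ true
reachable-mono V A {s} {s′} u w s≤s′ p =
  subst (λ t → reachable V A t u w ≡ true) (ℕₚ.m∸n+n≡m s≤s′) (reachable-+ V A (s′ ∸ s) s u w p)

reachable-step : ∀ V A s u v w → v ∈ V → reachable V A s u v ≡ true → A v w ≡ true → reachable V A (suc s) u w ≡ true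
reachable-step V A s u v w m p q =
  trans (cong (reachable V A s u w ∨_) (any⁺ _ V v m (cong₂ _∧_ p q))) (𝔹ₚ.∨-zeroʳ _)

reachable-edge : ∀ V A s u w → 1 ≤ s → u ∈ V → A u w ≡ true → reachable V A s u w ≡ true
reachable-edge V A s u w 1≤s m q = reachable-mono V A u w 1≤s (reachable-step V A 0 u u w m (≡ᵇ-refl u) q)

reachable-edge₂ : ∀ V A s u v w → 2 ≤ s → u ∈ V → v ∈ V → A u v ≡ true → A v w ≡ true → reachable V A s u w ≡ true
reachable-edge₂ V A s u v w 2≤s mu mv p q =
  reachable-mono V A u w 2≤s (reachable-step V A 1 u v w mv (reachable-edge V A 1 u v ℕₚ.≤-refl mu p) q)

count-≡ᵇ : ∀ V u → Distinct V → u ∈ V → count (u ≡ᵇ_) V ≡ 1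
count-≡ᵇ (x ∷ V) u (u∉ , _) (here refl) rewrite count-∷ (u ≡ᵇ_) u V | ≡ᵇ-refl u =
  cong suc (count≡0 _ V (λ v m → ≢⇒≡ᵇ-false u v (λ e → u∉ (subst (_∈ V) (sym e) m))))
count-≡ᵇ (x ∷ V) u (x∉ , dV) (there m) rewrite count-∷ (u ≡ᵇ_) x V | ≢⇒≡ᵇ-false u x (λ e → x∉ (subst (_∈ V) e m)) =
  count-≡ᵇ V u dV m

count-image : ∀ V (ℓ : ℕ → ℕ) (P : ℕ → Bool) J → Distinct V → Distinct J →
  (∀ i j → i ∈ J → j ∈ J → ℓ i ≡ ℓ j → i ≡ j) → (∀ j → j ∈ J → ℓ j ∈ V) →
  count (λ v → any (λ j → P j ∧ (v ≡ᵇ ℓ j)) J) V ≡ count P J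
count-image V ℓ P [] dV dJ inj into = count≡0 _ V (λ _ _ → refl)
count-image V ℓ P (j ∷ J) dV (j∉ , dJ) inj into =
  trans (count-∨ (λ v → P j ∧ (v ≡ᵇ ℓ j)) rest V disjoint)
    (trans (cong₂ _+_ head (count-image V ℓ P J dV dJ (λ a b ma mb → inj a b (there ma) (there mb)) (λ a m → into a (there m))))
      (trans (if-+ (P j) (count P J)) (sym (count-∷ P j J))))
  where
  rest : ℕ → Bool
  rest v = any (λ j → P j ∧ (v ≡ᵇ ℓ j)) J
  if-+ : ∀ b n → (if b then 1 else 0) + n ≡ (if b then suc n else n)
  if-+ true n = refl
  if-+ false n = refl
  head : count (λ v → P j ∧ (v ≡ᵇ ℓ j)) V ≡ (if P j then 1 else 0)
  head with P j
  ... | true = trans (count-cong _ _ V (λ v _ → ≡ᵇ-sym v (ℓ j))) (count-≡ᵇ V (ℓ j) dV (into j (here refl)))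
  ... | false = count≡0 _ V (λ _ _ → refl)
  disjoint : ∀ v → v ∈ V → ((P j ∧ (v ≡ᵇ ℓ j)) ∧ rest v) ≡ false
  disjoint v _ with v ≡ᵇ ℓ j in e
  ... | false = cong (_∧ rest v) (𝔹ₚ.∧-zeroʳ (P j))
  ... | true = trans (cong (_∧ rest v) (𝔹ₚ.∧-identityʳ (P j)))
                     (trans (cong (P j ∧_) (any≡false _ J other)) (𝔹ₚ.∧-zeroʳ (P j)))
    where
    other : ∀ k → k ∈ J → (P k ∧ (v ≡ᵇ ℓ k)) ≡ false
    other k mk with v ≡ᵇ ℓ k in e′
    ... | true = ⊥-elim (j∉ (subst (_∈ J) (sym (inj j k (here refl) (there mk)
                   (trans (sym (≡ᵇ⇒≡ {v} {ℓ j} e)) (≡ᵇ⇒≡ {v} {ℓ k} e′)))) mk))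
    ... | false = 𝔹ₚ.∧-zeroʳ (P k)

three≤count : ∀ V (p : ℕ → Bool) a b c → Distinct V → a ∈ V → b ∈ V → c ∈ V → a ≢ b → a ≢ c → b ≢ c →
  p a ≡ true → p b ≡ true → p c ≡ true → 3 ≤ count p V
three≤count V p a b c dV ma mb mc a≢b a≢c b≢c pa pb pc =
  ℕₚ.≤-trans (ℕₚ.≤-reflexive (sym (count-image V (λ x → x) (λ _ → true) (a ∷ b ∷ c ∷ []) dV
      ((λ { (here e) → a≢b e ; (there (here e)) → a≢c e }) , (λ { (here e) → b≢c e }) , (λ ()) , tt)
      (λ i j _ _ e → e) (λ { j (here refl) → ma ; j (there (here refl)) → mb ; j (there (there (here refl))) → mc }))))
    (count-mono _ p V (λ v _ q → onTriple v q))
  where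
  onTriple : ∀ v → any (λ j → true ∧ (v ≡ᵇ j)) (a ∷ b ∷ c ∷ []) ≡ true → p v ≡ true
  onTriple v q with any⁻ _ (a ∷ b ∷ c ∷ []) q
  ... | j , here refl , r rewrite ≡ᵇ⇒≡ {v} {a} r = pa
  ... | j , there (here refl) , r rewrite ≡ᵇ⇒≡ {v} {b} r = pb
  ... | j , there (there (here refl)) , r rewrite ≡ᵇ⇒≡ {v} {c} r = pc

wt-not-elementary : ∀ V s A u → u ∈ V →
  (Components.isEdgeComponent V A (reachable V A s) u ∨ Components.isCycleComponent V A (reachable V A s) u) ≡ false →
  wt V s A ≡ ℤ.0ℤ
wt-not-elementary V s A u mu bad = cong (λ e → if e then Components.sign V A (reachable V A s) else ℤ.0ℤ) (all≡false _ V u mu bad)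

wt-isolated : ∀ V s A u → Distinct V → u ∈ V → (∀ v → A u v ≡ false) → wt V s A ≡ ℤ.0ℤ
wt-isolated V s A u dV mu isolated = wt-not-elementary V s A u mu notElementary
  where
  onlySelf : ∀ t w → reachable V A t u w ≡ (u ≡ᵇ w)
  onlySelf zero w = refl
  onlySelf (suc t) w rewrite onlySelf t w =
    trans (cong ((u ≡ᵇ w) ∨_) (any≡false _ V (λ v _ → trans (cong (_∧ A v w) (onlySelf t v)) (noStep v)))) (𝔹ₚ.∨-identityʳ _)
    where
    noStep : ∀ v → ((u ≡ᵇ v) ∧ A v w) ≡ false
    noStep v with u ≡ᵇ v in e
    ... | false = refl
    ... | true = subst (λ x → A x w ≡ false) (≡ᵇ⇒≡ {u} {v} e) (isolated w)
  singleton : count (reachable V A s u) V ≡ 1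
  singleton = trans (count-cong _ _ V (λ w _ → onlySelf s w)) (count-≡ᵇ V u dV mu)
  notElementary : (Components.isEdgeComponent V A (reachable V A s) u ∨ Components.isCycleComponent V A (reachable V A s) u) ≡ false
  notElementary rewrite singleton = refl

wt-irregular : ∀ V s A u → u ∈ V → count (A u) V ≢ 2 → 3 ≤ count (reachable V A s u) V → wt V s A ≡ ℤ.0ℤ
wt-irregular V s A u mu deg≢2 3≤size = wt-not-elementary V s A u mu notElementary
  where
  notElementary : (Components.isEdgeComponent V A (reachable V A s) u ∨ Components.isCycleComponent V A (reachable V A s) u) ≡ false
  notElementary rewrite ≢⇒≡ᵇ-false _ 2 (λ e → ℕₚ.<-irrefl refl (subst (3 ≤_) e 3≤size)) =
    trans (cong ((3 ≤ᵇ count (reachable V A s u) V) ∧_)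
      (all≡false _ V u mu (trans (cong (λ b → not b ∨ (count (A u) V ≡ᵇ 2)) (reachable-refl V A s u)) (≢⇒≡ᵇ-false _ 2 deg≢2))))
      (𝔹ₚ.∧-zeroʳ _)

-- Model blocks

EdgesWithin : List ℕ → List (ℕ × ℕ) → Set
EdgesWithin V E = ∀ e → e ∈ E → (proj₁ e ∈ V) × (proj₂ e ∈ V)

mapEdges : (ℕ → ℕ) → List (ℕ × ℕ) → List (ℕ × ℕ)
mapEdges ℓ = map (λ e → (ℓ (proj₁ e) , ℓ (proj₂ e)))

avoids : ℕ → ℕ × ℕ → Bool
avoids x (a , b) = not (a ≡ᵇ x) ∧ not (b ≡ᵇ x)

edgeWithinᵇ : List ℕ → ℕ × ℕ → Bool
edgeWithinᵇ L e = memberᵇ (proj₁ e) L ∧ memberᵇ (proj₂ e) L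

edgeWithinᵇ-sound : ∀ L LE → all (edgeWithinᵇ L) LE ≡ true → EdgesWithin L LE
edgeWithinᵇ-sound L LE p e m = let q = all⁻ _ LE p e m in
  memberᵇ-sound _ L (proj₁ (∧-true⁻ q)) , memberᵇ-sound _ L (proj₂ (∧-true⁻ {memberᵇ (proj₁ e) L} q))

sameᵇ : Bool → Bool → Bool
sameᵇ a b = if a then b else not b

sameᵇ-sound : ∀ a b → sameᵇ a b ≡ true → a ≡ b
sameᵇ-sound true true _ = refl
sameᵇ-sound false false _ = refl

stableᵇ : List ℕ → (ℕ → ℕ → Bool) → ℕ → Bool
stableᵇ V A t = all (λ u → all (λ w → sameᵇ (reachable V A (suc t) u w) (reachable V A t u w)) V) V

stableᵇ-sound : ∀ V A t → stableᵇ V A t ≡ true → Stable V A t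
stableᵇ-sound V A t p u w mu mw = sameᵇ-sound _ _ (all⁻ _ V (all⁻ _ V p u mu) w mw)

adjOf-mapEdges : ∀ (ℓ : ℕ → ℕ) (L : List ℕ) → OrderEmbeddingOn L ℓ → ∀ c → EdgesWithin L c →
  ∀ u v → u ∈ L → v ∈ L → adjOf (mapEdges ℓ c) (ℓ u) (ℓ v) ≡ adjOf c u v
adjOf-mapEdges ℓ L emb [] c⊆L u v mu mv = refl
adjOf-mapEdges ℓ L emb ((a , b) ∷ c) c⊆L u v mu mv with c⊆L (a , b) (here refl)
... | ma , mb rewrite ≡ᵇ-pres emb u a mu ma | ≡ᵇ-pres emb v b mv mb | ≡ᵇ-pres emb u b mu mb | ≡ᵇ-pres emb v a mv ma =
  cong ((((u ≡ᵇ a) ∧ (v ≡ᵇ b)) ∨ ((u ≡ᵇ b) ∧ (v ≡ᵇ a))) ∨_) (adjOf-mapEdges ℓ L emb c (λ e m → c⊆L e (there m)) u v mu mv)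

Supported-mapEdges : ∀ (ℓ : ℕ → ℕ) (L : List ℕ) c → EdgesWithin L c → Supported (adjOf (mapEdges ℓ c)) (map ℓ L)
Supported-mapEdges ℓ L c c⊆L u v p with adjOf⁻ (mapEdges ℓ c) u v p
... | a , b , m , r with ∈-map⁻ _ m
... | (a′ , b′) , m′ , refl with c⊆L (a′ , b′) m′ | r
... | ma , mb | inj₁ (refl , refl) = ∈-map⁺ ℓ ma , ∈-map⁺ ℓ mb
... | ma , mb | inj₂ (refl , refl) = ∈-map⁺ ℓ mb , ∈-map⁺ ℓ ma

Supported-sublist : ∀ (V : List ℕ) E → EdgesWithin V E → ∀ S → S ∈ sublists E → Supported (adjOf S) V
Supported-sublist V E E⊆V S mS u v p with adjOf⁻ S u v p
... | a , b , m , r with E⊆V (a , b) (sublists-⊆ E S mS (a , b) m) | r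
... | ma , mb | inj₁ (refl , refl) = ma , mb
... | ma , mb | inj₂ (refl , refl) = mb , ma

wt-block : ∀ (ℓ : ℕ → ℕ) (Loc : List ℕ) (t j : ℕ) → OrderEmbeddingOn Loc ℓ →
  ∀ c → EdgesWithin Loc c → stableᵇ Loc (adjOf c) t ≡ true →
  wt (map ℓ Loc) (j + t) (adjOf (mapEdges ℓ c)) ≡ wt Loc t (adjOf c)
wt-block ℓ Loc t j emb c c⊆Loc st =
  trans (wt-relabel Loc ℓ emb (j + t) (adjOf c) (adjOf (mapEdges ℓ c)) (adjOf-mapEdges ℓ Loc emb c c⊆Loc))
        (wt-stable Loc (adjOf c) t (stableᵇ-sound Loc (adjOf c) t st) j)

-- A model block (Loc, LE) on small local vertex numbers, placed by ℓ and with no edge to the rest,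
-- splits off as a factor; its value is computed on the model, the `≡ true` hypotheses by evaluation.
qList-block : ∀ (ℓ : ℕ → ℕ) (Loc : List ℕ) (LE : List (ℕ × ℕ)) (t : ℕ) → OrderEmbeddingOn Loc ℓ →
  all (edgeWithinᵇ Loc) LE ≡ true → all (λ c → stableᵇ Loc (adjOf c) t) (sublists LE) ≡ true →
  ∀ V₂ E₂ j → Distinct (map ℓ Loc ++ V₂) → EdgesWithin V₂ E₂ →
  qList (map ℓ Loc ++ V₂) (j + t) (mapEdges ℓ LE ++ E₂) ≡ qList Loc t LE ℤ.* qList V₂ (j + t) E₂
qList-block ℓ Loc LE t emb LE⊆Loc stable V₂ E₂ j dV E₂⊆V₂ = begin
  qList V s (mapEdges ℓ LE ++ E₂)
    ≡⟨ ∑-sublists-++ (mapEdges ℓ LE) E₂ _ ⟩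
  ∑[ sublists (mapEdges ℓ LE) ] (λ c → ∑[ sublists E₂ ] (λ S → wt V s (adjOf (c ++ S))))
    ≡⟨ cong (λ L → ∑[ L ] (λ c → ∑[ sublists E₂ ] (λ S → wt V s (adjOf (c ++ S))))) (sublists-map _ LE) ⟩
  ∑[ map (mapEdges ℓ) (sublists LE) ] (λ c → ∑[ sublists E₂ ] (λ S → wt V s (adjOf (c ++ S))))
    ≡⟨ ∑-map (sublists LE) (mapEdges ℓ) _ ⟩
  ∑[ sublists LE ] (λ c → ∑[ sublists E₂ ] (λ S → wt V s (adjOf (mapEdges ℓ c ++ S))))
    ≡⟨ ∑-cong (sublists LE) _ _ (λ c mc → trans (∑-cong (sublists E₂) _ _ (λ S mS → factor c mc S mS))
                                               (∑-*ˡ (sublists E₂) (wt Loc t (adjOf c)) (λ S → wt V₂ s (adjOf S)))) ⟩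
  ∑[ sublists LE ] (λ c → wt Loc t (adjOf c) ℤ.* qList V₂ s E₂)
    ≡⟨ ∑-*ʳ (sublists LE) _ _ ⟩
  qList Loc t LE ℤ.* qList V₂ s E₂ ∎
  where
  open ≡-Reasoning
  s = j + t
  V = map ℓ Loc ++ V₂
  c⊆Loc : ∀ c → c ∈ sublists LE → EdgesWithin Loc c
  c⊆Loc c mc e m = edgeWithinᵇ-sound Loc LE LE⊆Loc e (sublists-⊆ LE c mc e m)
  factor : ∀ c → c ∈ sublists LE → ∀ S → S ∈ sublists E₂ →
    wt V s (adjOf (mapEdges ℓ c ++ S)) ≡ wt Loc t (adjOf c) ℤ.* wt V₂ s (adjOf S)
  factor c mc S mS =
    trans (wt-cong V s _ (λ u v → adjOf (mapEdges ℓ c) u v ∨ adjOf S u v) (λ u v _ _ → adjOf-++ (mapEdges ℓ c) S u v))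
    (trans (wt-⊎ (map ℓ Loc) V₂ s (adjOf (mapEdges ℓ c)) (adjOf S)
              (Supported-mapEdges ℓ Loc c (c⊆Loc c mc)) (Supported-sublist V₂ E₂ E₂⊆V₂ S mS) (Distinct-disjoint _ V₂ dV))
    (cong (ℤ._* wt V₂ s (adjOf S)) (wt-block ℓ Loc t j emb c (c⊆Loc c mc) (all⁻ _ (sublists LE) stable c mc))))

blockDegree : List ℕ → List (ℕ × ℕ) → ℕ → ℕ
blockDegree Ix H i = count (adjOf H i) Ix

within₂ : List ℕ → List (ℕ × ℕ) → ℕ → ℕ → Bool
within₂ Ix H i j = adjOf H i j ∨ any (λ k → adjOf H i k ∧ adjOf H k j) Ix

-- Certifies, by evaluation on the model block, that no configuration extending H is elementary:
-- some vertex whose neighbourhood lies inside the block has degree ≠ 2, and is either isolated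
-- or sees at least three vertices within distance 2.
witnessAt : List ℕ → List (ℕ × ℕ) → ℕ → Bool
witnessAt Ix H i = not (blockDegree Ix H i ≡ᵇ 2) ∧
  ((blockDegree Ix H i ≡ᵇ 0) ∨ (3 ≤ᵇ count (λ j → (j ≡ᵇ i) ∨ within₂ Ix H i j) Ix))

witness : List ℕ → List ℕ → List (ℕ × ℕ) → Bool
witness Ix Loc H = any (witnessAt Ix H) Loc

module Witness (V : List ℕ) (ℓ : ℕ → ℕ) (Ix Loc : List ℕ) (H S : List (ℕ × ℕ)) (s : ℕ)
  (into : ∀ i → i ∈ Ix → ℓ i ∈ V) (dV : Distinct V) (dIx : Distinct Ix) (emb : OrderEmbeddingOn Ix ℓ)
  (Loc⊆Ix : ∀ i → i ∈ Loc → i ∈ Ix)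
  (S-off : ∀ i v → i ∈ Loc → adjOf S (ℓ i) v ≡ false)
  (H⊆Ix : EdgesWithin Ix H)
  (2≤s : 2 ≤ s) where

  A : ℕ → ℕ → Bool
  A = adjOf (mapEdges ℓ H ++ S)

  lift : ∀ a b → adjOf H a b ≡ true → A (ℓ a) (ℓ b) ≡ true
  lift a b p = trans (adjOf-++ (mapEdges ℓ H) S (ℓ a) (ℓ b)) (cong (_∨ adjOf S (ℓ a) (ℓ b)) (lifted (adjOf⁻ H a b p)))
    where
    lifted : (∃ λ a′ → ∃ λ b′ → ((a′ , b′) ∈ H) × ((a ≡ a′ × b ≡ b′) ⊎ (a ≡ b′ × b ≡ a′))) →
      adjOf (mapEdges ℓ H) (ℓ a) (ℓ b) ≡ true
    lifted (_ , _ , m , inj₁ (refl , refl)) = adjOf⁺ (mapEdges ℓ H) (ℓ a) (ℓ b) (∈-map⁺ _ m)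
    lifted (_ , _ , m , inj₂ (refl , refl)) = adjOf⁺′ (mapEdges ℓ H) (ℓ b) (ℓ a) (∈-map⁺ _ m)

  adj-local : ∀ i → i ∈ Loc → ∀ v → A (ℓ i) v ≡ any (λ j → adjOf H i j ∧ (v ≡ᵇ ℓ j)) Ix
  adj-local i mi v = trans (adjOf-++ (mapEdges ℓ H) S (ℓ i) v)
    (trans (cong (adjOf (mapEdges ℓ H) (ℓ i) v ∨_) (S-off i v mi)) (trans (𝔹ₚ.∨-identityʳ _) (bool-ext to from)))
    where
    mIx = Loc⊆Ix i mi
    to : adjOf (mapEdges ℓ H) (ℓ i) v ≡ true → any (λ j → adjOf H i j ∧ (v ≡ᵇ ℓ j)) Ix ≡ true
    to p with adjOf⁻ (mapEdges ℓ H) (ℓ i) v p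
    ... | a , b , m , r with ∈-map⁻ _ m
    ... | (a′ , b′) , m′ , refl with H⊆Ix _ m′ | r
    ... | ma , mb | inj₁ (e , refl) rewrite injective emb i a′ mIx ma e =
      any⁺ _ Ix b′ mb (cong₂ _∧_ (adjOf⁺ H a′ b′ m′) (≡ᵇ-refl (ℓ b′)))
    ... | ma , mb | inj₂ (e , refl) rewrite injective emb i b′ mIx mb e =
      any⁺ _ Ix a′ ma (cong₂ _∧_ (adjOf⁺′ H a′ b′ m′) (≡ᵇ-refl (ℓ a′)))
    from : any (λ j → adjOf H i j ∧ (v ≡ᵇ ℓ j)) Ix ≡ true → adjOf (mapEdges ℓ H) (ℓ i) v ≡ true
    from p with any⁻ _ Ix p
    ... | j , mj , q with ≡ᵇ⇒≡ {v} {ℓ j} (proj₂ (∧-true⁻ {adjOf H i j} q)) | adjOf⁻ H i j (proj₁ (∧-true⁻ q))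
    ... | refl | _ , _ , m , inj₁ (refl , refl) = adjOf⁺ (mapEdges ℓ H) (ℓ i) (ℓ j) (∈-map⁺ _ m)
    ... | refl | _ , _ , m , inj₂ (refl , refl) = adjOf⁺′ (mapEdges ℓ H) (ℓ j) (ℓ i) (∈-map⁺ _ m)

  degree≡ : ∀ i → i ∈ Loc → count (A (ℓ i)) V ≡ blockDegree Ix H i
  degree≡ i mi = trans (count-cong _ _ V (λ v _ → adj-local i mi v)) (count-image V ℓ (adjOf H i) Ix dV dIx (injective emb) into)

  reaches : ∀ i → i ∈ Loc → ∀ v → any (λ j → ((j ≡ᵇ i) ∨ within₂ Ix H i j) ∧ (v ≡ᵇ ℓ j)) Ix ≡ true →
    reachable V A s (ℓ i) v ≡ true
  reaches i mi v p with any⁻ _ Ix p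
  ... | j , mj , r with ≡ᵇ⇒≡ {v} {ℓ j} (proj₂ (∧-true⁻ {(j ≡ᵇ i) ∨ within₂ Ix H i j} r)) | ∨-true⁻ {j ≡ᵇ i} (proj₁ (∧-true⁻ r))
  ... | refl | inj₁ e rewrite ≡ᵇ⇒≡ {j} {i} e = reachable-refl V A s (ℓ i)
  ... | refl | inj₂ e with ∨-true⁻ {adjOf H i j} e
  ... | inj₁ e₁ = reachable-edge V A s (ℓ i) (ℓ j) (ℕₚ.≤-trans (s≤s z≤n) 2≤s) (into i (Loc⊆Ix i mi)) (lift i j e₁)
  ... | inj₂ e₂ with any⁻ _ Ix e₂
  ... | k , mk , e₃ = reachable-edge₂ V A s (ℓ i) (ℓ k) (ℓ j) 2≤s (into i (Loc⊆Ix i mi)) (into k mk)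
                        (lift i k (proj₁ (∧-true⁻ e₃))) (lift k j (proj₂ (∧-true⁻ {adjOf H i k} e₃)))

  witness-sound : witness Ix Loc H ≡ true → wt V s A ≡ ℤ.0ℤ
  witness-sound p with any⁻ _ Loc p
  ... | i , mi , q with ∧-true⁻ {not (blockDegree Ix H i ≡ᵇ 2)} q
  ... | deg≢2 , isolated-or-spread with ∨-true⁻ {blockDegree Ix H i ≡ᵇ 0} isolated-or-spread
  ... | inj₁ deg≡0 = wt-isolated V s A (ℓ i) dV (into i (Loc⊆Ix i mi)) (λ v → trans (adj-local i mi v)
        (any≡false _ Ix (λ j mj → cong (_∧ (v ≡ᵇ ℓ j)) (count≡0⁻ _ Ix (≡ᵇ⇒≡ deg≡0) j mj))))
  ... | inj₂ spread = wt-irregular V s A (ℓ i) (into i (Loc⊆Ix i mi))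
        (λ e → true≢false (trans (sym (≡⇒≡ᵇ _ 2 (trans (sym (degree≡ i mi)) e))) (not≡true⁻ deg≢2)))
        (ℕₚ.≤-trans (≤ᵇ⇒≤ spread) (ℕₚ.≤-trans (ℕₚ.≤-reflexive (sym (count-image V ℓ _ Ix dV dIx (injective emb) into)))
          (count-mono _ _ V (λ v _ → reaches i mi v))))

avoids≡false⁻ : ∀ p a b → avoids p (a , b) ≡ false → (a ≡ p) ⊎ (b ≡ p)
avoids≡false⁻ p a b q with a ≡ᵇ p in e₁ | b ≡ᵇ p in e₂
... | true | _ = inj₁ (≡ᵇ⇒≡ e₁)
... | false | true = inj₂ (≡ᵇ⇒≡ e₂)

avoids≡true⁻ : ∀ p a b → avoids p (a , b) ≡ true → (a ≢ p) × (b ≢ p)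
avoids≡true⁻ p a b q with a ≡ᵇ p in e₁ | b ≡ᵇ p in e₂
... | false | false = (λ e → true≢false (trans (sym (≡⇒≡ᵇ a p e)) e₁)) , (λ e → true≢false (trans (sym (≡⇒≡ᵇ b p e)) e₂))

avoids⁺ : ∀ p a b → a ≢ p → b ≢ p → avoids p (a , b) ≡ true
avoids⁺ p a b a≢p b≢p rewrite ≢⇒≡ᵇ-false a p a≢p | ≢⇒≡ᵇ-false b p b≢p = refl

avoids-fst : ∀ p b → avoids p (p , b) ≡ false
avoids-fst p b rewrite ≡ᵇ-refl p = refl

LoopFree : List (ℕ × ℕ) → Set
LoopFree E = ∀ e → e ∈ E → proj₁ e ≢ proj₂ e

adjOf-outside : ∀ V S u → EdgesWithin V S → u ∉ V → ∀ v → adjOf S u v ≡ false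
adjOf-outside V S u S⊆V u∉V v with adjOf S u v in e
... | false = refl
... | true with adjOf⁻ S u v e
... | a , b , m , inj₁ (refl , refl) = ⊥-elim (u∉V (proj₁ (S⊆V _ m)))
... | a , b , m , inj₂ (refl , refl) = ⊥-elim (u∉V (proj₂ (S⊆V _ m)))

wt-pendant : ∀ V V″ s (u p : ℕ) (C S : List (ℕ × ℕ)) → Distinct V → u ∈ V → p ∈ V → (∀ v → v ∈ V″ → v ∈ V) →
  u ∉ p ∷ V″ → p ∉ V″ → (∀ v → adjOf C u v ≡ false) → EdgesWithin (p ∷ V″) S → LoopFree S → all (avoids p) S ≡ false →
  2 ≤ s → wt V s (adjOf ((u , p) ∷ C ++ S)) ≡ ℤ.0ℤ
wt-pendant V V″ s u p C S dV mu mp V″⊆V u∉ p∉V″ C-off S⊆ loopFree touches 2≤s =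
  wt-irregular V s A u mu degree≢2 three
  where
  A = adjOf ((u , p) ∷ C ++ S)
  u≢p : u ≢ p
  u≢p e = u∉ (here e)
  Au : ∀ v → A u v ≡ (p ≡ᵇ v)
  Au v = trans (cong₂ _∨_ head (trans (adjOf-++ C S u v) (cong₂ _∨_ (C-off v) (adjOf-outside (p ∷ V″) S u S⊆ u∉ v))))
    (𝔹ₚ.∨-identityʳ _)
    where
    head : (((u ≡ᵇ u) ∧ (v ≡ᵇ p)) ∨ ((u ≡ᵇ p) ∧ (v ≡ᵇ u))) ≡ (p ≡ᵇ v)
    head rewrite ≡ᵇ-refl u | ≢⇒≡ᵇ-false u p u≢p = trans (𝔹ₚ.∨-identityʳ _) (≡ᵇ-sym v p)
  degree≢2 : count (A u) V ≢ 2
  degree≢2 e = ℕₚ.1+n≢n {1} (sym (trans (sym (count-≡ᵇ V p dV mp)) (trans (count-cong _ _ V (λ v _ → sym (Au v))) e)))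
  neighbour : ∃ λ w → (w ∈ V″) × (adjOf S p w ≡ true)
  neighbour with all≡false⁻ _ S touches
  ... | (a , b) , m , q with avoids≡false⁻ p a b q | S⊆ _ m | loopFree _ m
  ... | inj₁ refl | _ , here refl | a≢b = ⊥-elim (a≢b refl)
  ... | inj₁ refl | _ , there mb | _ = b , mb , adjOf⁺ S a b m
  ... | inj₂ refl | here refl , _ | a≢b = ⊥-elim (a≢b refl)
  ... | inj₂ refl | there ma , _ | _ = a , ma , adjOf⁺′ S a b m
  w = proj₁ neighbour
  mw = proj₁ (proj₂ neighbour)
  Aup : A u p ≡ true
  Aup = trans (Au p) (≡ᵇ-refl p)
  Apw : A p w ≡ true
  Apw = trans (cong (((p ≡ᵇ u) ∧ (w ≡ᵇ p) ∨ (p ≡ᵇ p) ∧ (w ≡ᵇ u)) ∨_)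
    (trans (adjOf-++ C S p w) (trans (cong (adjOf C p w ∨_) (proj₂ (proj₂ neighbour))) (𝔹ₚ.∨-zeroʳ _)))) (𝔹ₚ.∨-zeroʳ _)
  three : 3 ≤ count (reachable V A s u) V
  three = three≤count V (reachable V A s u) u p w dV mu mp (V″⊆V w mw) u≢p
    (λ e → u∉ (there (subst (_∈ V″) (sym e) mw))) (λ e → p∉V″ (subst (_∈ V″) (sym e) mw))
    (reachable-refl V A s u)
    (reachable-edge V A s u p (ℕₚ.≤-trans (s≤s z≤n) 2≤s) mu Aup)
    (reachable-edge₂ V A s u p w 2≤s mu mp Aup Apw)

Supported-∨ : ∀ A₁ A₂ W V₁ V₂ → Supported A₁ V₁ → Supported A₂ V₂ → (∀ v → v ∈ V₁ → v ∈ W) → (∀ v → v ∈ V₂ → v ∈ W) →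
  Supported (λ u v → A₁ u v ∨ A₂ u v) W
Supported-∨ A₁ A₂ W V₁ V₂ supp₁ supp₂ V₁⊆W V₂⊆W u v p with ∨-true⁻ {A₁ u v} p
... | inj₁ q = V₁⊆W _ (proj₁ (supp₁ u v q)) , V₁⊆W _ (proj₂ (supp₁ u v q))
... | inj₂ q = V₂⊆W _ (proj₁ (supp₂ u v q)) , V₂⊆W _ (proj₂ (supp₂ u v q))

-- A model block on the local vertices Loc₀ ++ [ i₀ ] is attached to the rest of the graph only
-- through the bridge edge i₀ – p.  A configuration either omits the bridge, and then factors as
-- (block) × (rest), or contains it; then every block configuration touching i₀ is certified
-- non-elementary by `witness`, while every configuration of the rest touching p makes i₀ a pendant
-- vertex hanging at a vertex of degree ≥ 2.
module Bridge (ℓ : ℕ → ℕ) (Loc₀ : List ℕ) (i₀ p : ℕ) (LE : List (ℕ × ℕ)) (t : ℕ)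
  (emb : OrderEmbeddingOn (Loc₀ ++ i₀ ∷ p ∷ []) ℓ)
  (distinct : distinctᵇ (Loc₀ ++ i₀ ∷ p ∷ []) ≡ true)
  (LE⊆Loc : all (edgeWithinᵇ (Loc₀ ++ i₀ ∷ [])) LE ≡ true)
  (stable : all (λ c → stableᵇ (Loc₀ ++ i₀ ∷ []) (adjOf c) t) (sublists LE) ≡ true)
  (stable₀ : all (λ c → stableᵇ Loc₀ (adjOf c) t) (sublists (filterᵇ (avoids i₀) LE)) ≡ true)
  (stableEdge : stableᵇ (i₀ ∷ p ∷ []) (adjOf ((i₀ , p) ∷ [])) t ≡ true)
  (witnesses : all (λ c → all (avoids i₀) c ∨ witness (Loc₀ ++ i₀ ∷ p ∷ []) (Loc₀ ++ i₀ ∷ []) ((i₀ , p) ∷ c)) (sublists LE) ≡ true)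
  (2≤t : 2 ≤ t)
  (V″ : List ℕ) (E″ : List (ℕ × ℕ)) (j : ℕ)
  (dV : Distinct (map ℓ Loc₀ ++ ℓ i₀ ∷ ℓ p ∷ V″))
  (E″⊆ : EdgesWithin (ℓ p ∷ V″) E″)
  (loopFree : LoopFree E″) where

  private
    Ix = Loc₀ ++ i₀ ∷ p ∷ []
    Loc = Loc₀ ++ i₀ ∷ []
    V = map ℓ Loc₀ ++ ℓ i₀ ∷ ℓ p ∷ V″
    s = j + t
    bridge = (ℓ i₀ , ℓ p)
    E″ₚ = filterᵇ (avoids (ℓ p)) E″

    2≤s : 2 ≤ s
    2≤s = ℕₚ.≤-trans 2≤t (ℕₚ.m≤n+m t j)

    i₀∈Ix : i₀ ∈ Ix
    i₀∈Ix = ∈-++⁺ʳ Loc₀ (here refl)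

    p∈Ix : p ∈ Ix
    p∈Ix = ∈-++⁺ʳ Loc₀ (there (here refl))

    Loc⊆Ix : ∀ i → i ∈ Loc → i ∈ Ix
    Loc⊆Ix i m with ∈-++⁻ Loc₀ m
    ... | inj₁ m₁ = ∈-++⁺ˡ m₁
    ... | inj₂ (here refl) = i₀∈Ix

    edge⊆Ix : ∀ a → a ∈ i₀ ∷ p ∷ [] → a ∈ Ix
    edge⊆Ix a (here refl) = i₀∈Ix
    edge⊆Ix a (there (here refl)) = p∈Ix

    into : ∀ i → i ∈ Ix → ℓ i ∈ V
    into i m with ∈-++⁻ Loc₀ m
    ... | inj₁ m₁ = ∈-++⁺ˡ (∈-map⁺ ℓ m₁)
    ... | inj₂ (here refl) = ∈-++⁺ʳ (map ℓ Loc₀) (here refl)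
    ... | inj₂ (there (here refl)) = ∈-++⁺ʳ (map ℓ Loc₀) (there (here refl))

    V≡ : map ℓ Loc ++ ℓ p ∷ V″ ≡ V
    V≡ = trans (cong (_++ ℓ p ∷ V″) (Listₚ.map-++ ℓ Loc₀ (i₀ ∷ []))) (Listₚ.++-assoc (map ℓ Loc₀) (ℓ i₀ ∷ []) (ℓ p ∷ V″))

    dIx : Distinct Ix
    dIx = distinctᵇ-sound Ix distinct

    local-outside : ∀ i → i ∈ Loc → ℓ i ∉ ℓ p ∷ V″
    local-outside i m = Distinct-disjoint (map ℓ Loc) _ (subst Distinct (sym V≡) dV) (ℓ i) (∈-map⁺ ℓ m)

    ∈-tail : ∀ {z} → z ∈ ℓ p ∷ V″ → z ≢ ℓ p → z ∈ V″
    ∈-tail (here e) z≢p = ⊥-elim (z≢p e)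
    ∈-tail (there m) _ = m

    c⊆Loc : ∀ c → c ∈ sublists LE → EdgesWithin Loc c
    c⊆Loc c mc e m = edgeWithinᵇ-sound Loc LE LE⊆Loc e (sublists-⊆ LE c mc e m)

    S⊆ : ∀ {F} S → S ∈ sublists F → (∀ e → e ∈ F → e ∈ E″) → EdgesWithin (ℓ p ∷ V″) S
    S⊆ S mS F⊆E″ e m = E″⊆ e (F⊆E″ e (sublists-⊆ _ S mS e m))

  without-bridge : ∑[ sublists (mapEdges ℓ LE ++ E″) ] (λ S → wt V s (adjOf S)) ≡ qList Loc t LE ℤ.* qList (ℓ p ∷ V″) s E″
  without-bridge = trans (cong (λ W → qList W s (mapEdges ℓ LE ++ E″)) (sym V≡))
    (qList-block ℓ Loc LE t (OrderEmbeddingOn-⊆ Loc⊆Ix emb) LE⊆Loc stable (ℓ p ∷ V″) E″ j (subst Distinct (sym V≡) dV) E″⊆)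

  with-bridge-touching-i₀ : ∀ c → c ∈ sublists LE → all (avoids i₀) c ≡ false →
    ∑[ sublists E″ ] (λ S → wt V s (adjOf (bridge ∷ mapEdges ℓ c ++ S))) ≡ ℤ.0ℤ
  with-bridge-touching-i₀ c mc touches = ∑-0 (sublists E″) _ (λ S mS →
    Witness.witness-sound V ℓ Ix Loc ((i₀ , p) ∷ c) S s into dV dIx emb Loc⊆Ix
      (λ i v mi → adjOf-outside (ℓ p ∷ V″) S (ℓ i) (S⊆ S mS (λ _ m → m)) (local-outside i mi) v)
      H⊆Ix 2≤s certified)
    where
    certified : witness Ix Loc ((i₀ , p) ∷ c) ≡ true
    certified with ∨-true⁻ {all (avoids i₀) c} (all⁻ _ (sublists LE) witnesses c mc)
    ... | inj₁ q = ⊥-elim (true≢false (trans (sym q) touches))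
    ... | inj₂ q = q
    H⊆Ix : EdgesWithin Ix ((i₀ , p) ∷ c)
    H⊆Ix e (here refl) = i₀∈Ix , p∈Ix
    H⊆Ix e (there m) = let (x , y) = c⊆Loc c mc e m in Loc⊆Ix _ x , Loc⊆Ix _ y

  module _ (c : List (ℕ × ℕ)) (mc : c ∈ sublists (filterᵇ (avoids i₀) LE)) where
    private
      c⊆Loc₀ : EdgesWithin Loc₀ c
      c⊆Loc₀ (x , y) m with ∈-filterᵇ⁻ (avoids i₀) LE (sublists-⊆ _ c mc (x , y) m)
      ... | mLE , av with edgeWithinᵇ-sound Loc LE LE⊆Loc (x , y) mLE | avoids≡true⁻ i₀ x y av
      ... | mx , my | x≢i₀ , y≢i₀ = inLoc₀ x mx x≢i₀ , inLoc₀ y my y≢i₀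
        where
        inLoc₀ : ∀ z → z ∈ Loc → z ≢ i₀ → z ∈ Loc₀
        inLoc₀ z m′ z≢i₀ with ∈-++⁻ Loc₀ m′
        ... | inj₁ q = q
        ... | inj₂ (here e) = ⊥-elim (z≢i₀ e)

      c-off-i₀ : ∀ v → adjOf (mapEdges ℓ c) (ℓ i₀) v ≡ false
      c-off-i₀ v with adjOf (mapEdges ℓ c) (ℓ i₀) v in e
      ... | false = refl
      ... | true with adjOf⁻ (mapEdges ℓ c) (ℓ i₀) v e
      ... | x , y , m , r with ∈-map⁻ _ m
      ... | (x′ , y′) , m′ , refl with c⊆Loc₀ _ m′ | r
      ... | mx , _ | inj₁ (e₁ , _) = ⊥-elim (Distinct-disjoint Loc₀ _ dIx x′ mx
              (here (sym (injective emb i₀ x′ i₀∈Ix (∈-++⁺ˡ mx) e₁))))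
      ... | _ , my | inj₂ (e₁ , _) = ⊥-elim (Distinct-disjoint Loc₀ _ dIx y′ my
              (here (sym (injective emb i₀ y′ i₀∈Ix (∈-++⁺ˡ my) e₁))))

      Supported-rest : ∀ S → S ∈ sublists E″ₚ → Supported (adjOf S) V″
      Supported-rest S mS u v q with adjOf⁻ S u v q
      ... | x , y , m , r with ∈-filterᵇ⁻ (avoids (ℓ p)) E″ (sublists-⊆ _ S mS (x , y) m)
      ... | mE , av with E″⊆ (x , y) mE | avoids≡true⁻ (ℓ p) x y av
      ... | hx , hy | x≢p , y≢p with r
      ... | inj₁ (refl , refl) = ∈-tail hx x≢p , ∈-tail hy y≢p
      ... | inj₂ (refl , refl) = ∈-tail hy y≢p , ∈-tail hx x≢p

      dEdge+rest : Distinct (ℓ i₀ ∷ ℓ p ∷ V″)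
      dEdge+rest = Distinct-++ʳ (map ℓ Loc₀) _ dV

      edge⊆ : EdgesWithin (i₀ ∷ p ∷ []) ((i₀ , p) ∷ [])
      edge⊆ e (here refl) = here refl , there (here refl)

      wtEdge = wt (i₀ ∷ p ∷ []) t (adjOf ((i₀ , p) ∷ []))

      three-blocks : ∀ S → S ∈ sublists E″ₚ →
        wt V s (adjOf (bridge ∷ mapEdges ℓ c ++ S)) ≡ wt Loc₀ t (adjOf c) ℤ.* (wtEdge ℤ.* wt V″ s (adjOf S))
      three-blocks S mS = begin
        wt V s (adjOf (bridge ∷ mapEdges ℓ c ++ S))
          ≡⟨ wt-cong V s _ (λ u v → adjOf (mapEdges ℓ c) u v ∨ (adjOf (bridge ∷ []) u v ∨ adjOf S u v))
               (λ u v _ _ → trans (cong (_ ∨_) (adjOf-++ (mapEdges ℓ c) S u v)) (∨-rotate _ (adjOf (mapEdges ℓ c) u v) (adjOf S u v))) ⟩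
        wt V s (λ u v → adjOf (mapEdges ℓ c) u v ∨ (adjOf (bridge ∷ []) u v ∨ adjOf S u v))
          ≡⟨ wt-⊎ (map ℓ Loc₀) (ℓ i₀ ∷ ℓ p ∷ V″) s (adjOf (mapEdges ℓ c)) (λ u v → adjOf (bridge ∷ []) u v ∨ adjOf S u v)
               (Supported-mapEdges ℓ Loc₀ c c⊆Loc₀)
               (Supported-∨ _ _ _ (ℓ i₀ ∷ ℓ p ∷ []) V″ (Supported-mapEdges ℓ (i₀ ∷ p ∷ []) ((i₀ , p) ∷ []) edge⊆)
                 (Supported-rest S mS) (λ { v (here refl) → here refl ; v (there (here refl)) → there (here refl) })
                 (λ v m → there (there m)))
               (Distinct-disjoint (map ℓ Loc₀) _ dV) ⟩
        wt (map ℓ Loc₀) s (adjOf (mapEdges ℓ c)) ℤ.* wt (ℓ i₀ ∷ ℓ p ∷ V″) s (λ u v → adjOf (bridge ∷ []) u v ∨ adjOf S u v)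
          ≡⟨ cong₂ ℤ._*_ (wt-block ℓ Loc₀ t j (OrderEmbeddingOn-⊆ (λ _ → ∈-++⁺ˡ) emb) c c⊆Loc₀ (all⁻ _ _ stable₀ c mc))
               (wt-⊎ (ℓ i₀ ∷ ℓ p ∷ []) V″ s (adjOf (bridge ∷ [])) (adjOf S)
                 (Supported-mapEdges ℓ (i₀ ∷ p ∷ []) ((i₀ , p) ∷ []) edge⊆) (Supported-rest S mS)
                 (Distinct-disjoint (ℓ i₀ ∷ ℓ p ∷ []) V″ dEdge+rest)) ⟩
        wt Loc₀ t (adjOf c) ℤ.* (wt (ℓ i₀ ∷ ℓ p ∷ []) s (adjOf (bridge ∷ [])) ℤ.* wt V″ s (adjOf S))
          ≡⟨ cong (λ w → wt Loc₀ t (adjOf c) ℤ.* (w ℤ.* wt V″ s (adjOf S)))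
               (wt-block ℓ (i₀ ∷ p ∷ []) t j (OrderEmbeddingOn-⊆ edge⊆Ix emb) ((i₀ , p) ∷ []) edge⊆ stableEdge) ⟩
        wt Loc₀ t (adjOf c) ℤ.* (wtEdge ℤ.* wt V″ s (adjOf S)) ∎
        where
        open ≡-Reasoning
        ∨-rotate : ∀ x y z → (x ∨ (y ∨ z)) ≡ (y ∨ ((x ∨ false) ∨ z))
        ∨-rotate true true z = refl
        ∨-rotate true false z = refl
        ∨-rotate false true z = refl
        ∨-rotate false false z = refl

    with-bridge-avoiding-i₀ : ∑[ sublists E″ ] (λ S → wt V s (adjOf (bridge ∷ mapEdges ℓ c ++ S))) ≡
      wt Loc₀ t (adjOf c) ℤ.* (wtEdge ℤ.* qList V″ s E″ₚ)
    with-bridge-avoiding-i₀ = begin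
      ∑[ sublists E″ ] (λ S → wt V s (adjOf (bridge ∷ mapEdges ℓ c ++ S)))
        ≡⟨ ∑-sublists-filterᵇ (avoids (ℓ p)) E″ _ (λ S mS touches →
             wt-pendant V V″ s (ℓ i₀) (ℓ p) (mapEdges ℓ c) S dV (into i₀ i₀∈Ix) (into p p∈Ix)
               (λ v m → ∈-++⁺ʳ (map ℓ Loc₀) (there (there m)))
               (local-outside i₀ (∈-++⁺ʳ Loc₀ (here refl))) (proj₁ (proj₂ dEdge+rest)) c-off-i₀
               (S⊆ S mS (λ _ m → m)) (λ e m → loopFree e (sublists-⊆ E″ S mS e m)) touches 2≤s) ⟩
      ∑[ sublists E″ₚ ] (λ S → wt V s (adjOf (bridge ∷ mapEdges ℓ c ++ S)))
        ≡⟨ ∑-cong (sublists E″ₚ) _ _ three-blocks ⟩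
      ∑[ sublists E″ₚ ] (λ S → wt Loc₀ t (adjOf c) ℤ.* (wtEdge ℤ.* wt V″ s (adjOf S)))
        ≡⟨ ∑-*ˡ (sublists E″ₚ) (wt Loc₀ t (adjOf c)) _ ⟩
      wt Loc₀ t (adjOf c) ℤ.* ∑[ sublists E″ₚ ] (λ S → wtEdge ℤ.* wt V″ s (adjOf S))
        ≡⟨ cong (wt Loc₀ t (adjOf c) ℤ.*_) (∑-*ˡ (sublists E″ₚ) wtEdge (λ S → wt V″ s (adjOf S))) ⟩
      wt Loc₀ t (adjOf c) ℤ.* (wtEdge ℤ.* qList V″ s E″ₚ) ∎
      where open ≡-Reasoning

  with-bridge : ∑[ sublists (mapEdges ℓ LE ++ E″) ] (λ S → wt V s (adjOf (bridge ∷ S))) ≡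
    qList Loc₀ t (filterᵇ (avoids i₀) LE) ℤ.* (wt (i₀ ∷ p ∷ []) t (adjOf ((i₀ , p) ∷ [])) ℤ.* qList V″ s E″ₚ)
  with-bridge = begin
    ∑[ sublists (mapEdges ℓ LE ++ E″) ] (λ S → wt V s (adjOf (bridge ∷ S)))
      ≡⟨ ∑-sublists-++ (mapEdges ℓ LE) E″ (λ S → wt V s (adjOf (bridge ∷ S))) ⟩
    ∑[ sublists (mapEdges ℓ LE) ] rest
      ≡⟨ cong (λ L → ∑[ L ] rest) (sublists-map _ LE) ⟩
    ∑[ map (mapEdges ℓ) (sublists LE) ] rest
      ≡⟨ ∑-map (sublists LE) (mapEdges ℓ) rest ⟩
    ∑[ sublists LE ] (λ c → rest (mapEdges ℓ c))
      ≡⟨ ∑-sublists-filterᵇ (avoids i₀) LE _ with-bridge-touching-i₀ ⟩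
    ∑[ sublists (filterᵇ (avoids i₀) LE) ] (λ c → rest (mapEdges ℓ c))
      ≡⟨ ∑-cong _ _ _ with-bridge-avoiding-i₀ ⟩
    ∑[ sublists (filterᵇ (avoids i₀) LE) ] (λ c → wt Loc₀ t (adjOf c) ℤ.* _)
      ≡⟨ ∑-*ʳ (sublists (filterᵇ (avoids i₀) LE)) _ (λ c → wt Loc₀ t (adjOf c)) ⟩
    qList Loc₀ t (filterᵇ (avoids i₀) LE) ℤ.* (wt (i₀ ∷ p ∷ []) t (adjOf ((i₀ , p) ∷ [])) ℤ.* qList V″ s E″ₚ) ∎
    where
    open ≡-Reasoning
    rest : List (ℕ × ℕ) → ℤ
    rest S₁ = ∑[ sublists E″ ] (λ S₂ → wt V s (adjOf (bridge ∷ S₁ ++ S₂)))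

  qList-bridge : qList V s (mapEdges ℓ ((i₀ , p) ∷ LE) ++ E″) ≡
    qList Loc t LE ℤ.* qList (ℓ p ∷ V″) s E″ ℤ.+
    qList Loc₀ t (filterᵇ (avoids i₀) LE) ℤ.* (wt (i₀ ∷ p ∷ []) t (adjOf ((i₀ , p) ∷ [])) ℤ.* qList V″ s E″ₚ)
  qList-bridge = trans (∑-sublists-∷ bridge (mapEdges ℓ LE ++ E″) _) (cong₂ ℤ._+_ without-bridge with-bridge)

nth : List ℕ → ℕ → ℕ
nth [] _ = 0
nth (x ∷ xs) zero = x
nth (x ∷ xs) (suc i) = nth xs i

Increasing : List ℕ → Set
Increasing [] = ⊤
Increasing (x ∷ []) = ⊤
Increasing (x ∷ y ∷ r) = (x < y) × Increasing (y ∷ r)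

nth-head< : ∀ x xs j → Increasing (x ∷ xs) → j < length xs → x < nth xs j
nth-head< x (y ∷ xs) zero (x<y , _) _ = x<y
nth-head< x (y ∷ xs) (suc j) (x<y , inc) (s≤s j<) = ℕₚ.<-trans x<y (nth-head< y xs j inc j<)

nth-strictMono : ∀ xs i j → Increasing xs → i < j → j < length xs → nth xs i < nth xs j
nth-strictMono (x ∷ xs) zero (suc j) inc _ (s≤s j<) = nth-head< x xs j inc j<
nth-strictMono (x ∷ []) (suc i) (suc j) inc (s≤s i<j) (s≤s ())
nth-strictMono (x ∷ y ∷ xs) (suc i) (suc j) (_ , inc) (s≤s i<j) (s≤s j<) = nth-strictMono (y ∷ xs) i j inc i<j j<

nth-orderEmbedding : ∀ Ls Ix → Increasing Ls → all (_<ᵇ length Ls) Ix ≡ true → OrderEmbeddingOn Ix (nth Ls)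
nth-orderEmbedding Ls Ix inc bounded = record
  { ≡ᵇ-pres = λ a b ma mb → ≡ᵇ-pres′ a b (bound a ma) (bound b mb)
  ; <ᵇ-pres = λ a b ma mb → <ᵇ-pres′ a b (bound a ma) (bound b mb)
  }
  where
  bound : ∀ a → a ∈ Ix → a < length Ls
  bound a m = <ᵇ⇒< (all⁻ _ Ix bounded a m)
  <ᵇ-pres′ : ∀ i j → i < length Ls → j < length Ls → (nth Ls i <ᵇ nth Ls j) ≡ (i <ᵇ j)
  <ᵇ-pres′ i j i< j< with ℕₚ.<-cmp i j
  ... | tri< i<j _ _ = trans (<⇒<ᵇ (nth-strictMono Ls i j inc i<j j<)) (sym (<⇒<ᵇ i<j))
  ... | tri≈ _ refl _ = trans (≮⇒<ᵇ-false {nth Ls i} (ℕₚ.<-irrefl refl)) (sym (≮⇒<ᵇ-false {i} (ℕₚ.<-irrefl refl)))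
  ... | tri> _ _ j<i = trans (≮⇒<ᵇ-false (λ q → ℕₚ.<-asym q (nth-strictMono Ls j i inc j<i i<))) (sym (≮⇒<ᵇ-false (ℕₚ.<-asym j<i)))
  ≡ᵇ-pres′ : ∀ i j → i < length Ls → j < length Ls → (nth Ls i ≡ᵇ nth Ls j) ≡ (i ≡ᵇ j)
  ≡ᵇ-pres′ i j i< j< with ℕₚ.<-cmp i j
  ... | tri< i<j _ _ = trans (≢⇒≡ᵇ-false _ _ (ℕₚ.<⇒≢ (nth-strictMono Ls i j inc i<j j<))) (sym (≢⇒≡ᵇ-false _ _ (ℕₚ.<⇒≢ i<j)))
  ... | tri≈ _ refl _ = trans (≡ᵇ-refl (nth Ls i)) (sym (≡ᵇ-refl i))
  ... | tri> _ _ j<i = trans (≢⇒≡ᵇ-false _ _ (λ e → ℕₚ.<⇒≢ (nth-strictMono Ls j i inc j<i i<) (sym e)))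
                             (sym (≢⇒≡ᵇ-false _ _ (λ e → ℕₚ.<⇒≢ j<i (sym e))))

-- Paths with houses

range : ℕ → ℕ → List ℕ
range b zero = []
range b (suc L) = b ∷ range (suc b) L

pathEdgesFrom : ℕ → ℕ → List (ℕ × ℕ)
pathEdgesFrom b zero = []
pathEdgesFrom b (suc zero) = []
pathEdgesFrom b (suc (suc L)) = (b , suc b) ∷ pathEdgesFrom (suc b) (suc L)

-- A house is recorded as (a , x): it sits on the path edge a (joining a ∸ 1 and a) and adds the
-- vertices x and suc x, as in Defs.houseEdges.
houseEdgesAt : ℕ × ℕ → List (ℕ × ℕ)
houseEdgesAt (a , x) = (x , suc x) ∷ (a ∸ 1 , x) ∷ (a ∸ 1 , suc x) ∷ (a , x) ∷ (a , suc x) ∷ []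

houseEdgeList : List (ℕ × ℕ) → List (ℕ × ℕ)
houseEdgeList [] = []
houseEdgeList (h ∷ hs) = houseEdgesAt h ++ houseEdgeList hs

houseVertices : List (ℕ × ℕ) → List ℕ
houseVertices [] = []
houseVertices ((a , x) ∷ hs) = x ∷ suc x ∷ houseVertices hs

familyVertices : ℕ → ℕ → List (ℕ × ℕ) → List ℕ
familyVertices b L hs = range b L ++ houseVertices hs

familyEdges : ℕ → ℕ → List (ℕ × ℕ) → List (ℕ × ℕ)
familyEdges b L hs = pathEdgesFrom b L ++ houseEdgeList hs

-- Each house sits on an edge b + 2t – b + 2t + 1, consecutive houses are at least two edges apart,
-- every house edge lies below top, and the house vertices increase from xlo on.
WellPlaced : ℕ → ℕ → ℕ → List (ℕ × ℕ) → Set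
WellPlaced b top xlo [] = ⊤
WellPlaced b top xlo ((a , x) ∷ hs) =
  (Σ ℕ λ t → a ≡ suc (b + 2 * t)) × (a < top) × (xlo ≤ x) × WellPlaced (suc a) top (suc (suc x)) hs

qFam : ℕ → ℕ → List (ℕ × ℕ) → ℕ → ℤ
qFam b L hs s = qList (familyVertices b L hs) s (familyEdges b L hs)

-- The family with its first path vertex b deleted.
qFam⁻ : ℕ → ℕ → List (ℕ × ℕ) → ℕ → ℤ
qFam⁻ b L hs s = qList (range (suc b) (L ∸ 1) ++ houseVertices hs) s (filterᵇ (avoids b) (familyEdges b L hs))

∈-range⁻ : ∀ b L v → v ∈ range b L → (b ≤ v) × (v < b + L)
∈-range⁻ b (suc L) v (here refl) = ℕₚ.≤-refl , ℕₚ.m<m+n b (s≤s z≤n)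
∈-range⁻ b (suc L) v (there m) with ∈-range⁻ (suc b) L v m
... | p , q = ℕₚ.<⇒≤ p , subst (v <_) (sym (ℕₚ.+-suc b L)) q

∈-range⁺ : ∀ b L v → b ≤ v → v < b + L → v ∈ range b L
∈-range⁺ b zero v p q = ⊥-elim (ℕₚ.<-irrefl refl (ℕₚ.<-≤-trans q (subst (_≤ v) (sym (ℕₚ.+-identityʳ b)) p)))
∈-range⁺ b (suc L) v p q with ℕₚ.m≤n⇒m<n∨m≡n p
... | inj₂ refl = here refl
... | inj₁ b<v = there (∈-range⁺ (suc b) L v b<v (subst (v <_) (ℕₚ.+-suc b L) q))

Distinct-range : ∀ b L → Distinct (range b L)
Distinct-range b zero = tt
Distinct-range b (suc L) = (λ m → ℕₚ.<-irrefl refl (proj₁ (∈-range⁻ (suc b) L b m))) , Distinct-range (suc b) L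

houseVertices-≥ : ∀ b top xlo hs → WellPlaced b top xlo hs → ∀ v → v ∈ houseVertices hs → xlo ≤ v
houseVertices-≥ b top xlo ((a , x) ∷ hs) (_ , _ , xlo≤x , wp) v (here refl) = xlo≤x
houseVertices-≥ b top xlo ((a , x) ∷ hs) (_ , _ , xlo≤x , wp) v (there (here refl)) = ℕₚ.m≤n⇒m≤1+n xlo≤x
houseVertices-≥ b top xlo ((a , x) ∷ hs) (_ , _ , xlo≤x , wp) v (there (there m)) =
  ℕₚ.≤-trans xlo≤x (ℕₚ.≤-trans (ℕₚ.n≤1+n x) (ℕₚ.≤-trans (ℕₚ.n≤1+n (suc x)) (houseVertices-≥ _ _ _ hs wp v m)))

Distinct-houseVertices : ∀ b top xlo hs → WellPlaced b top xlo hs → Distinct (houseVertices hs)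
Distinct-houseVertices b top xlo [] wp = tt
Distinct-houseVertices b top xlo ((a , x) ∷ hs) (_ , _ , _ , wp) =
  (λ { (here e) → ℕₚ.1+n≢n (sym e) ; (there m) → ℕₚ.<-irrefl refl (ℕₚ.≤-trans (ℕₚ.n≤1+n (suc x)) (houseVertices-≥ _ _ _ hs wp x m)) }) ,
  (λ m → ℕₚ.<-irrefl refl (ℕₚ.<-≤-trans (ℕₚ.n<1+n (suc x)) (houseVertices-≥ _ _ _ hs wp (suc x) m))) ,
  Distinct-houseVertices _ _ _ hs wp

familyVertices-≥ : ∀ b L xlo hs → b + L ≤ xlo → WellPlaced b (b + L) xlo hs → ∀ v → v ∈ familyVertices b L hs → b ≤ v
familyVertices-≥ b L xlo hs top≤xlo wp v m with ∈-++⁻ (range b L) m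
... | inj₁ r = proj₁ (∈-range⁻ b L v r)
... | inj₂ r = ℕₚ.≤-trans (ℕₚ.m≤m+n b L) (ℕₚ.≤-trans top≤xlo (houseVertices-≥ _ _ _ hs wp v r))

Distinct-familyVertices : ∀ b L xlo hs → b + L ≤ xlo → WellPlaced b (b + L) xlo hs → Distinct (familyVertices b L hs)
Distinct-familyVertices b L xlo hs top≤xlo wp = Distinct-++ (range b L) (houseVertices hs) (Distinct-range b L) (Distinct-houseVertices _ _ _ hs wp)
  (λ v m m′ → ℕₚ.<-irrefl refl (ℕₚ.<-≤-trans (proj₂ (∈-range⁻ b L v m)) (ℕₚ.≤-trans top≤xlo (houseVertices-≥ _ _ _ hs wp v m′))))

∈-pathEdgesFrom⁻ : ∀ b L e → e ∈ pathEdgesFrom b L → ∃ λ v → (e ≡ (v , suc v)) × (b ≤ v) × (suc v < b + L)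
∈-pathEdgesFrom⁻ b (suc (suc L)) e (here refl) =
  b , refl , ℕₚ.≤-refl , subst (suc b <_) (sym (ℕₚ.+-suc b (suc L))) (s≤s (ℕₚ.m<m+n b (s≤s z≤n)))
∈-pathEdgesFrom⁻ b (suc (suc L)) e (there m) with ∈-pathEdgesFrom⁻ (suc b) (suc L) e m
... | v , refl , p , q = v , refl , ℕₚ.<⇒≤ p , subst (suc v <_) (sym (ℕₚ.+-suc b (suc L))) q

EndpointIn : ℕ → ℕ → List (ℕ × ℕ) → ℕ → Set
EndpointIn b L hs v = v ∈ range b L ⊎ v ∈ houseVertices hs

spoke-endpoints : ∀ b L hs u y → b ≤ u → u < b + L → b + L ≤ y → y ∈ houseVertices hs →
  (EndpointIn b L hs u × EndpointIn b L hs y) × (u ≢ y)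
spoke-endpoints b L hs u y b≤u u<top top≤y y∈ =
  (inj₁ (∈-range⁺ b L u b≤u u<top) , inj₂ y∈) , (λ u≡y → ℕₚ.<-irrefl u≡y (ℕₚ.<-≤-trans u<top top≤y))

∈-houseEdgeList⁻ : ∀ b L b′ xlo hs → b ≤ b′ → b + L ≤ xlo → WellPlaced b′ (b + L) xlo hs → ∀ e → e ∈ houseEdgeList hs →
  (EndpointIn b L hs (proj₁ e) × EndpointIn b L hs (proj₂ e)) × (proj₁ e ≢ proj₂ e)
∈-houseEdgeList⁻ b L b′ xlo ((a , x) ∷ hs) b≤b′ top≤xlo ((t , refl) , a<top , xlo≤x , wp) e m
  with ∈-++⁻ (houseEdgesAt (a , x)) m
... | inj₁ (here refl) = (inj₂ (here refl) , inj₂ (there (here refl))) , (λ e → ℕₚ.1+n≢n (sym e))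
... | inj₁ (there (here refl)) =
  spoke-endpoints b L ((a , x) ∷ hs) (b′ + 2 * t) x (ℕₚ.≤-trans b≤b′ (ℕₚ.m≤m+n b′ _)) (ℕₚ.<-trans (ℕₚ.n<1+n _) a<top)
    (ℕₚ.≤-trans top≤xlo xlo≤x) (here refl)
... | inj₁ (there (there (here refl))) =
  spoke-endpoints b L ((a , x) ∷ hs) (b′ + 2 * t) (suc x) (ℕₚ.≤-trans b≤b′ (ℕₚ.m≤m+n b′ _)) (ℕₚ.<-trans (ℕₚ.n<1+n _) a<top)
    (ℕₚ.m≤n⇒m≤1+n (ℕₚ.≤-trans top≤xlo xlo≤x)) (there (here refl))
... | inj₁ (there (there (there (here refl)))) =
  spoke-endpoints b L ((a , x) ∷ hs) (suc (b′ + 2 * t)) x (ℕₚ.m≤n⇒m≤1+n (ℕₚ.≤-trans b≤b′ (ℕₚ.m≤m+n b′ _))) a<top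
    (ℕₚ.≤-trans top≤xlo xlo≤x) (here refl)
... | inj₁ (there (there (there (there (here refl))))) =
  spoke-endpoints b L ((a , x) ∷ hs) (suc (b′ + 2 * t)) (suc x) (ℕₚ.m≤n⇒m≤1+n (ℕₚ.≤-trans b≤b′ (ℕₚ.m≤m+n b′ _))) a<top
    (ℕₚ.m≤n⇒m≤1+n (ℕₚ.≤-trans top≤xlo xlo≤x)) (there (here refl))
... | inj₂ m′ with ∈-houseEdgeList⁻ b L (suc a) (suc (suc x)) hs
                     (ℕₚ.≤-trans b≤b′ (ℕₚ.≤-trans (ℕₚ.m≤m+n b′ (2 * t)) (ℕₚ.≤-trans (ℕₚ.n≤1+n _) (ℕₚ.n≤1+n _))))
                     (ℕₚ.≤-trans top≤xlo (ℕₚ.≤-trans xlo≤x (ℕₚ.≤-trans (ℕₚ.n≤1+n x) (ℕₚ.n≤1+n (suc x))))) wp e m′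
...   | (p , q) , r = (later p , later q) , r
  where
  later : ∀ {v} → EndpointIn b L hs v → EndpointIn b L ((a , x) ∷ hs) v
  later (inj₁ z) = inj₁ z
  later (inj₂ z) = inj₂ (there (there z))

∈-familyEdges⁻ : ∀ b L xlo hs → b + L ≤ xlo → WellPlaced b (b + L) xlo hs → ∀ e → e ∈ familyEdges b L hs →
  EdgesWithin (familyVertices b L hs) (e ∷ []) × (proj₁ e ≢ proj₂ e)
∈-familyEdges⁻ b L xlo hs top≤xlo wp e m with ∈-++⁻ (pathEdgesFrom b L) m
... | inj₁ mp with ∈-pathEdgesFrom⁻ b L e mp
...   | v , refl , b≤v , v+1<top =
  (λ { _ (here refl) → ∈-++⁺ˡ (∈-range⁺ b L v b≤v (ℕₚ.<-trans (ℕₚ.n<1+n v) v+1<top)) ,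
                       ∈-++⁺ˡ (∈-range⁺ b L (suc v) (ℕₚ.m≤n⇒m≤1+n b≤v) v+1<top) }) ,
  (λ e → ℕₚ.1+n≢n (sym e))
∈-familyEdges⁻ b L xlo hs top≤xlo wp e m | inj₂ mh with ∈-houseEdgeList⁻ b L b xlo hs ℕₚ.≤-refl top≤xlo wp e mh
... | (p , q) , r = (λ { _ (here refl) → toFamily p , toFamily q }) , r
  where
  toFamily : ∀ {v} → EndpointIn b L hs v → v ∈ familyVertices b L hs
  toFamily (inj₁ z) = ∈-++⁺ˡ z
  toFamily (inj₂ z) = ∈-++⁺ʳ (range b L) z

familyEdges-within : ∀ b L xlo hs → b + L ≤ xlo → WellPlaced b (b + L) xlo hs → EdgesWithin (familyVertices b L hs) (familyEdges b L hs)
familyEdges-within b L xlo hs top≤xlo wp e m = proj₁ (∈-familyEdges⁻ b L xlo hs top≤xlo wp e m) e (here refl)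

familyEdges-loopFree : ∀ b L xlo hs → b + L ≤ xlo → WellPlaced b (b + L) xlo hs → LoopFree (familyEdges b L hs)
familyEdges-loopFree b L xlo hs top≤xlo wp e m = proj₂ (∈-familyEdges⁻ b L xlo hs top≤xlo wp e m)

filterᵇ-avoids-below : ∀ b′ b L xlo hs → b′ < b → b + L ≤ xlo → WellPlaced b (b + L) xlo hs →
  filterᵇ (avoids b′) (familyEdges b L hs) ≡ familyEdges b L hs
filterᵇ-avoids-below b′ b L xlo hs b′<b top≤xlo wp = filterᵇ-all _ _ (λ e m →
  let (p , q) = familyEdges-within b L xlo hs top≤xlo wp e m
      above : ∀ {v} → v ∈ familyVertices b L hs → v ≢ b′
      above {v} mv v≡b′ = ℕₚ.<-irrefl (sym v≡b′) (ℕₚ.<-≤-trans b′<b (familyVertices-≥ b L xlo hs top≤xlo wp v mv))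
  in avoids⁺ b′ (proj₁ e) (proj₂ e) (above p) (above q))

qList-↭ᵛ : ∀ {V V′} → V ↭ V′ → ∀ s E → qList V s E ≡ qList V′ s E
qList-↭ᵛ p s E = ∑-cong (sublists E) _ _ (λ S _ → wt-↭ p s (adjOf S))

qList-↭ᵉ : ∀ V s {E E′} → E ↭ E′ → qList V s E ≡ qList V s E′
qList-↭ᵉ V s p = ∑-sublists-↭ p (λ S → wt V s (adjOf S)) (λ q → wt-cong V s _ _ (λ u v _ _ → adjOf-↭ q u v))

offset-elim : ∀ (P : ℕ → Set) t s → t ≤ s → (∀ j → P (j + t)) → P s
offset-elim P t s t≤s f = subst P (ℕₚ.m∸n+n≡m t≤s) (f (s ∸ t))

top-shift : ∀ b L → b + suc (suc (suc L)) ≡ suc (suc b) + suc L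
top-shift b L = trans (ℕₚ.+-suc b (suc (suc L))) (cong suc (ℕₚ.+-suc b (suc L)))

-- Transfer relations

3+b≤top : ∀ b L → 3 + b ≤ b + suc (suc (suc L))
3+b≤top b L = ℕₚ.≤-trans (ℕₚ.≤-reflexive (ℕₚ.+-comm 3 b)) (ℕₚ.+-monoʳ-≤ b (ℕₚ.m≤m+n 3 L))

module Rest (b L : ℕ) (hs : List (ℕ × ℕ)) (xlo : ℕ)
  (top≤xlo : suc (suc b) + suc L ≤ xlo) (wp : WellPlaced (suc (suc b)) (suc (suc b) + suc L) xlo hs) where

  V″ : List ℕ
  V″ = range (suc (suc (suc b))) L ++ houseVertices hs

  E″ : List (ℕ × ℕ)
  E″ = familyEdges (suc (suc b)) (suc L) hs

  E″⊆ : EdgesWithin (suc (suc b) ∷ V″) E″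
  E″⊆ = familyEdges-within (suc (suc b)) (suc L) xlo hs top≤xlo wp

  loopFree : LoopFree E″
  loopFree = familyEdges-loopFree (suc (suc b)) (suc L) xlo hs top≤xlo wp

  distinct : Distinct (suc (suc b) ∷ V″)
  distinct = Distinct-familyVertices (suc (suc b)) (suc L) xlo hs top≤xlo wp

  above : ∀ v → v ∈ suc (suc b) ∷ V″ → suc (suc b) ≤ v
  above = familyVertices-≥ (suc (suc b)) (suc L) xlo hs top≤xlo wp

  E″-avoids-below : ∀ c → c < suc (suc b) → filterᵇ (avoids c) E″ ≡ E″
  E″-avoids-below c c< = filterᵇ-avoids-below c (suc (suc b)) (suc L) xlo hs c< top≤xlo wp

filterᵇ-avoids-house : ∀ b x E → b < x → filterᵇ (avoids b) (houseEdgesAt (suc b , x) ++ E) ≡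
  (x , suc x) ∷ (suc b , x) ∷ (suc b , suc x) ∷ filterᵇ (avoids b) E
filterᵇ-avoids-house b x E b<x =
  trans (filterᵇ-accept (avoids b) (x , suc x) _ (avoids⁺ b _ _ x≢b x+1≢b)) (cong ((x , suc x) ∷_)
  (trans (filterᵇ-reject (avoids b) (b , x) _ (avoids-fst b x))
  (trans (filterᵇ-reject (avoids b) (b , suc x) _ (avoids-fst b (suc x)))
  (trans (filterᵇ-accept (avoids b) (suc b , x) _ (avoids⁺ b _ _ ℕₚ.1+n≢n x≢b)) (cong ((suc b , x) ∷_)
  (filterᵇ-accept (avoids b) (suc b , suc x) _ (avoids⁺ b _ _ ℕₚ.1+n≢n x+1≢b)))))))
  where
  x≢b : x ≢ b
  x≢b e = ℕₚ.<-irrefl (sym e) b<x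
  x+1≢b : suc x ≢ b
  x+1≢b e = ℕₚ.<-irrefl (sym e) (ℕₚ.m≤n⇒m≤1+n b<x)

-- The first two path vertices b, b + 1 carry a house (vertices x, x + 1), so the block is a K₄;
-- its model has local vertices 0 = b, 1 = b + 1, 2 = b + 2 (the far end of the bridge), 3 = x, 4 = x + 1.
qFam-K4-step : ∀ b L x hs xlo s → b + suc (suc (suc L)) ≤ xlo →
  WellPlaced b (b + suc (suc (suc L))) xlo ((suc b , x) ∷ hs) → 3 ≤ s →
  qFam b (suc (suc (suc L))) ((suc b , x) ∷ hs) s ≡
    -[1+ 2 ] ℤ.* qFam (suc (suc b)) (suc L) hs s ℤ.+ + 2 ℤ.* qFam⁻ (suc (suc b)) (suc L) hs s
qFam-K4-step b L x hs xlo s top≤xlo wp@(_ , _ , xlo≤x , wpRest) 3≤s = begin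
  qFam b (suc (suc (suc L))) ((suc b , x) ∷ hs) s
    ≡⟨ qList-↭ᵛ vertices↭ s (familyEdges b (suc (suc (suc L))) ((suc b , x) ∷ hs)) ⟩
  qList Vblk s (familyEdges b (suc (suc (suc L))) ((suc b , x) ∷ hs))
    ≡⟨ qList-↭ᵉ Vblk s edges↭ ⟩
  qList Vblk s (mapEdges (nth Ls) ((1 , 2) ∷ LE) ++ E″)
    ≡⟨ offset-elim Bridged 3 s 3≤s (λ j → Bridge.qList-bridge (nth Ls) (0 ∷ 3 ∷ 4 ∷ []) 1 2 LE 3
         (nth-orderEmbedding Ls _ increasing refl) refl refl refl refl refl refl (s≤s (s≤s z≤n)) V″ E″ j
         (Distinct-↭ vertices↭ (Distinct-familyVertices b _ xlo _ top≤xlo wp)) E″⊆ loopFree) ⟩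
  -[1+ 2 ] ℤ.* qFam (suc (suc b)) (suc L) hs s ℤ.+ -[1+ 1 ] ℤ.* (-[1+ 0 ] ℤ.* qFam⁻ (suc (suc b)) (suc L) hs s)
    ≡⟨ rearrange (qFam (suc (suc b)) (suc L) hs s) (qFam⁻ (suc (suc b)) (suc L) hs s) ⟩
  -[1+ 2 ] ℤ.* qFam (suc (suc b)) (suc L) hs s ℤ.+ + 2 ℤ.* qFam⁻ (suc (suc b)) (suc L) hs s ∎
  where
  open ≡-Reasoning
  rearrange : ∀ X Y → -[1+ 2 ] ℤ.* X ℤ.+ -[1+ 1 ] ℤ.* (-[1+ 0 ] ℤ.* Y) ≡ -[1+ 2 ] ℤ.* X ℤ.+ + 2 ℤ.* Y
  rearrange = solve 2 (λ X Y → con -[1+ 2 ] :* X :+ con -[1+ 1 ] :* (con -[1+ 0 ] :* Y) := con -[1+ 2 ] :* X :+ con (+ 2) :* Y) refl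
    where open +-*-Solver
  top≤x : b + suc (suc (suc L)) ≤ x
  top≤x = ℕₚ.≤-trans top≤xlo xlo≤x
  open Rest b L hs (suc (suc x)) (ℕₚ.≤-trans (ℕₚ.≤-reflexive (sym (top-shift b L))) (ℕₚ.≤-trans top≤x (ℕₚ.m≤n⇒m≤1+n (ℕₚ.n≤1+n x))))
    (subst (λ top → WellPlaced (suc (suc b)) top (suc (suc x)) hs) (top-shift b L) wpRest)
  Ls = b ∷ suc b ∷ suc (suc b) ∷ x ∷ suc x ∷ []
  LE : List (ℕ × ℕ)
  LE = (0 , 1) ∷ (3 , 4) ∷ (0 , 3) ∷ (0 , 4) ∷ (1 , 3) ∷ (1 , 4) ∷ []
  Vblk = b ∷ x ∷ suc x ∷ suc b ∷ suc (suc b) ∷ V″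
  Bridged : ℕ → Set
  Bridged s′ = qList Vblk s′ (mapEdges (nth Ls) ((1 , 2) ∷ LE) ++ E″) ≡
    -[1+ 2 ] ℤ.* qFam (suc (suc b)) (suc L) hs s′ ℤ.+ -[1+ 1 ] ℤ.* (-[1+ 0 ] ℤ.* qFam⁻ (suc (suc b)) (suc L) hs s′)
  increasing : Increasing Ls
  increasing = ℕₚ.n<1+n b , ℕₚ.n<1+n (suc b) , ℕₚ.≤-trans (3+b≤top b L) top≤x , ℕₚ.n<1+n x , tt
  vertices↭ : familyVertices b (suc (suc (suc L))) ((suc b , x) ∷ hs) ↭ Vblk
  vertices↭ = prep b (↭ₚ.shifts (suc b ∷ suc (suc b) ∷ range (suc (suc (suc b))) L) (x ∷ suc x ∷ []))
  edges↭ : familyEdges b (suc (suc (suc L))) ((suc b , x) ∷ hs) ↭ mapEdges (nth Ls) ((1 , 2) ∷ LE) ++ E″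
  edges↭ = swap _ _ (↭ₚ.shifts (pathEdgesFrom (suc (suc b)) (suc L)) (houseEdgesAt (suc b , x)))

-- Deleting b leaves the triangle b + 1, x, x + 1 hanging from the bridge b + 1 – b + 2; local vertices
-- 0 = b + 1, 1 = b + 2, 2 = x, 3 = x + 1.
qFam⁻-K4-step : ∀ b L x hs xlo s → b + suc (suc (suc L)) ≤ xlo →
  WellPlaced b (b + suc (suc (suc L))) xlo ((suc b , x) ∷ hs) → 3 ≤ s →
  qFam⁻ b (suc (suc (suc L))) ((suc b , x) ∷ hs) s ≡
    -[1+ 1 ] ℤ.* qFam (suc (suc b)) (suc L) hs s ℤ.+ qFam⁻ (suc (suc b)) (suc L) hs s
qFam⁻-K4-step b L x hs xlo s top≤xlo wp@(_ , _ , xlo≤x , wpRest) 3≤s = begin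
  qFam⁻ b (suc (suc (suc L))) ((suc b , x) ∷ hs) s
    ≡⟨ qList-↭ᵛ vertices↭ s (filterᵇ (avoids b) (familyEdges b (suc (suc (suc L))) ((suc b , x) ∷ hs))) ⟩
  qList Vblk s (filterᵇ (avoids b) (familyEdges b (suc (suc (suc L))) ((suc b , x) ∷ hs)))
    ≡⟨ qList-↭ᵉ Vblk s (↭trans (↭ₚ.filter-↭ (λ e → T? (avoids b e)) edges↭) (↭-reflexive filtered)) ⟩
  qList Vblk s (mapEdges (nth Ls) ((0 , 1) ∷ LE) ++ E″)
    ≡⟨ offset-elim Bridged 3 s 3≤s (λ j → Bridge.qList-bridge (nth Ls) (2 ∷ 3 ∷ []) 0 1 LE 3
         (nth-orderEmbedding Ls _ increasing refl) refl refl refl refl refl refl (s≤s (s≤s z≤n)) V″ E″ j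
         (Distinct-↭ vertices↭ (proj₂ (Distinct-familyVertices b _ xlo _ top≤xlo wp))) E″⊆ loopFree) ⟩
  -[1+ 1 ] ℤ.* qFam (suc (suc b)) (suc L) hs s ℤ.+ -[1+ 0 ] ℤ.* (-[1+ 0 ] ℤ.* qFam⁻ (suc (suc b)) (suc L) hs s)
    ≡⟨ rearrange (qFam (suc (suc b)) (suc L) hs s) (qFam⁻ (suc (suc b)) (suc L) hs s) ⟩
  -[1+ 1 ] ℤ.* qFam (suc (suc b)) (suc L) hs s ℤ.+ qFam⁻ (suc (suc b)) (suc L) hs s ∎
  where
  open ≡-Reasoning
  rearrange : ∀ X Y → -[1+ 1 ] ℤ.* X ℤ.+ -[1+ 0 ] ℤ.* (-[1+ 0 ] ℤ.* Y) ≡ -[1+ 1 ] ℤ.* X ℤ.+ Y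
  rearrange = solve 2 (λ X Y → con -[1+ 1 ] :* X :+ con -[1+ 0 ] :* (con -[1+ 0 ] :* Y) := con -[1+ 1 ] :* X :+ Y) refl
    where open +-*-Solver
  top≤x : b + suc (suc (suc L)) ≤ x
  top≤x = ℕₚ.≤-trans top≤xlo xlo≤x
  open Rest b L hs (suc (suc x)) (ℕₚ.≤-trans (ℕₚ.≤-reflexive (sym (top-shift b L))) (ℕₚ.≤-trans top≤x (ℕₚ.m≤n⇒m≤1+n (ℕₚ.n≤1+n x))))
    (subst (λ top → WellPlaced (suc (suc b)) top (suc (suc x)) hs) (top-shift b L) wpRest)
  Ls = suc b ∷ suc (suc b) ∷ x ∷ suc x ∷ []
  LE : List (ℕ × ℕ)
  LE = (2 , 3) ∷ (0 , 2) ∷ (0 , 3) ∷ []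
  Vblk = x ∷ suc x ∷ suc b ∷ suc (suc b) ∷ V″
  Bridged : ℕ → Set
  Bridged s′ = qList Vblk s′ (mapEdges (nth Ls) ((0 , 1) ∷ LE) ++ E″) ≡
    -[1+ 1 ] ℤ.* qFam (suc (suc b)) (suc L) hs s′ ℤ.+ -[1+ 0 ] ℤ.* (-[1+ 0 ] ℤ.* qFam⁻ (suc (suc b)) (suc L) hs s′)
  b<x : b < x
  b<x = ℕₚ.≤-trans (s≤s (ℕₚ.m≤n⇒m≤1+n (ℕₚ.n≤1+n b))) (ℕₚ.≤-trans (3+b≤top b L) top≤x)
  increasing : Increasing Ls
  increasing = ℕₚ.n<1+n (suc b) , ℕₚ.≤-trans (3+b≤top b L) top≤x , ℕₚ.n<1+n x , tt
  vertices↭ : range (suc b) (suc (suc L)) ++ houseVertices ((suc b , x) ∷ hs) ↭ Vblk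
  vertices↭ = ↭ₚ.shifts (suc b ∷ suc (suc b) ∷ range (suc (suc (suc b))) L) (x ∷ suc x ∷ [])
  edges↭ : familyEdges b (suc (suc (suc L))) ((suc b , x) ∷ hs) ↭ (b , suc b) ∷ (suc b , suc (suc b)) ∷ houseEdgesAt (suc b , x) ++ E″
  edges↭ = prep _ (prep _ (↭ₚ.shifts (pathEdgesFrom (suc (suc b)) (suc L)) (houseEdgesAt (suc b , x))))
  b+2≢b : suc (suc b) ≢ b
  b+2≢b e = ℕₚ.<-irrefl (sym e) (ℕₚ.≤-trans (ℕₚ.n≤1+n (suc b)) (ℕₚ.n<1+n (suc b)))
  filtered : filterᵇ (avoids b) ((b , suc b) ∷ (suc b , suc (suc b)) ∷ houseEdgesAt (suc b , x) ++ E″) ≡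
    mapEdges (nth Ls) ((0 , 1) ∷ LE) ++ E″
  filtered =
    trans (filterᵇ-reject (avoids b) (b , suc b) _ (avoids-fst b (suc b)))
    (trans (filterᵇ-accept (avoids b) (suc b , suc (suc b)) _ (avoids⁺ b _ _ ℕₚ.1+n≢n b+2≢b)) (cong ((suc b , suc (suc b)) ∷_)
    (trans (filterᵇ-avoids-house b x E″ b<x) (cong (λ E → (x , suc x) ∷ (suc b , x) ∷ (suc b , suc x) ∷ E)
    (E″-avoids-below b (ℕₚ.≤-trans (ℕₚ.n<1+n b) (ℕₚ.n≤1+n (suc b))))))))

-- No house on the first edge: the block is the single edge b – b + 1.
module _ (b L : ℕ) (hs : List (ℕ × ℕ)) (xlo : ℕ)
  (top≤xlo : suc (suc b) + suc L ≤ xlo) (wp : WellPlaced (suc (suc b)) (suc (suc b) + suc L) xlo hs) where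
  open Rest b L hs xlo top≤xlo wp

  private
    b+2-above : ∀ v → v ∈ suc (suc b) ∷ V″ → suc b < v
    b+2-above v m = above v m

  qFam-path-step : ∀ s → 2 ≤ s → qFam b (suc (suc (suc L))) hs s ≡ ℤ.- qFam (suc (suc b)) (suc L) hs s
  qFam-path-step s 2≤s = begin
    qFam b (suc (suc (suc L))) hs s
      ≡⟨ qList-↭ᵉ (familyVertices b (suc (suc (suc L))) hs) s (swap {xs = E″} (b , suc b) (suc b , suc (suc b)) ↭refl) ⟩
    qList (familyVertices b (suc (suc (suc L))) hs) s ((suc b , suc (suc b)) ∷ (b , suc b) ∷ E″)
      ≡⟨ offset-elim Bridged 2 s 2≤s (λ j → Bridge.qList-bridge (nth Ls) (0 ∷ []) 1 2 ((0 , 1) ∷ []) 2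
           (nth-orderEmbedding Ls _ (ℕₚ.n<1+n b , ℕₚ.n<1+n (suc b) , tt) refl) refl refl refl refl refl refl (s≤s (s≤s z≤n))
           V″ E″ j distinct₀ E″⊆ loopFree) ⟩
    -[1+ 0 ] ℤ.* qFam (suc (suc b)) (suc L) hs s ℤ.+ + 0 ℤ.* (-[1+ 0 ] ℤ.* qFam⁻ (suc (suc b)) (suc L) hs s)
      ≡⟨ rearrange (qFam (suc (suc b)) (suc L) hs s) (qFam⁻ (suc (suc b)) (suc L) hs s) ⟩
    ℤ.- qFam (suc (suc b)) (suc L) hs s ∎
    where
    open ≡-Reasoning
    rearrange : ∀ X Y → -[1+ 0 ] ℤ.* X ℤ.+ + 0 ℤ.* (-[1+ 0 ] ℤ.* Y) ≡ ℤ.- X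
    rearrange = solve 2 (λ X Y → con -[1+ 0 ] :* X :+ con (+ 0) :* (con -[1+ 0 ] :* Y) := :- X) refl
      where open +-*-Solver
    Ls = b ∷ suc b ∷ suc (suc b) ∷ []
    Bridged : ℕ → Set
    Bridged s′ = qList (familyVertices b (suc (suc (suc L))) hs) s′ ((suc b , suc (suc b)) ∷ (b , suc b) ∷ E″) ≡
      -[1+ 0 ] ℤ.* qFam (suc (suc b)) (suc L) hs s′ ℤ.+ + 0 ℤ.* (-[1+ 0 ] ℤ.* qFam⁻ (suc (suc b)) (suc L) hs s′)
    distinct₀ : Distinct (b ∷ suc b ∷ suc (suc b) ∷ V″)
    distinct₀ = (λ { (here e) → ℕₚ.1+n≢n (sym e) ; (there m) → ℕₚ.<-irrefl refl (ℕₚ.<-trans (ℕₚ.n<1+n b) (b+2-above b m)) }) ,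
                (λ m → ℕₚ.<-irrefl refl (b+2-above (suc b) m)) , distinct

  qFam⁻-path-step : ∀ s → 2 ≤ s → qFam⁻ b (suc (suc (suc L))) hs s ≡ ℤ.- qFam⁻ (suc (suc b)) (suc L) hs s
  qFam⁻-path-step s 2≤s = begin
    qFam⁻ b (suc (suc (suc L))) hs s
      ≡⟨ cong (qList (range (suc b) (suc (suc L)) ++ houseVertices hs) s) filtered ⟩
    qList (range (suc b) (suc (suc L)) ++ houseVertices hs) s ((suc b , suc (suc b)) ∷ E″)
      ≡⟨ offset-elim Bridged 2 s 2≤s (λ j → Bridge.qList-bridge (nth Ls) [] 0 1 [] 2
           (nth-orderEmbedding Ls _ (ℕₚ.n<1+n (suc b) , tt) refl) refl refl refl refl refl refl (s≤s (s≤s z≤n))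
           V″ E″ j distinct₁ E″⊆ loopFree) ⟩
    + 0 ℤ.* qFam (suc (suc b)) (suc L) hs s ℤ.+ + 1 ℤ.* (-[1+ 0 ] ℤ.* qFam⁻ (suc (suc b)) (suc L) hs s)
      ≡⟨ rearrange (qFam (suc (suc b)) (suc L) hs s) (qFam⁻ (suc (suc b)) (suc L) hs s) ⟩
    ℤ.- qFam⁻ (suc (suc b)) (suc L) hs s ∎
    where
    open ≡-Reasoning
    rearrange : ∀ X Y → + 0 ℤ.* X ℤ.+ + 1 ℤ.* (-[1+ 0 ] ℤ.* Y) ≡ ℤ.- Y
    rearrange = solve 2 (λ X Y → con (+ 0) :* X :+ con (+ 1) :* (con -[1+ 0 ] :* Y) := :- Y) refl
      where open +-*-Solver
    Ls = suc b ∷ suc (suc b) ∷ []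
    Bridged : ℕ → Set
    Bridged s′ = qList (range (suc b) (suc (suc L)) ++ houseVertices hs) s′ ((suc b , suc (suc b)) ∷ E″) ≡
      + 0 ℤ.* qFam (suc (suc b)) (suc L) hs s′ ℤ.+ + 1 ℤ.* (-[1+ 0 ] ℤ.* qFam⁻ (suc (suc b)) (suc L) hs s′)
    distinct₁ : Distinct (suc b ∷ suc (suc b) ∷ V″)
    distinct₁ = (λ m → ℕₚ.<-irrefl refl (b+2-above (suc b) m)) , distinct
    filtered : filterᵇ (avoids b) (familyEdges b (suc (suc (suc L))) hs) ≡ (suc b , suc (suc b)) ∷ E″
    filtered = trans (filterᵇ-reject (avoids b) (b , suc b) _ (avoids-fst b (suc b)))
      (trans (filterᵇ-accept (avoids b) (suc b , suc (suc b)) E″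
               (avoids⁺ b _ _ ℕₚ.1+n≢n (λ e → ℕₚ.<-irrefl (sym e) (ℕₚ.≤-trans (ℕₚ.n<1+n b) (ℕₚ.n≤1+n (suc b))))))
        (cong ((suc b , suc (suc b)) ∷_) (E″-avoids-below b (ℕₚ.≤-trans (ℕₚ.n<1+n b) (ℕₚ.n≤1+n (suc b))))))

qFam-K4 : ∀ b x s → 3 ≤ s → Distinct (b ∷ suc b ∷ x ∷ suc x ∷ []) → suc b < x → qFam b 2 ((suc b , x) ∷ []) s ≡ -[1+ 2 ]
qFam-K4 b x s 3≤s distinct b+1<x = offset-elim (λ s′ → qFam b 2 ((suc b , x) ∷ []) s′ ≡ -[1+ 2 ]) 3 s 3≤s (λ j →
  qList-block (nth Ls) (0 ∷ 1 ∷ 2 ∷ 3 ∷ []) ((0 , 1) ∷ (2 , 3) ∷ (0 , 2) ∷ (0 , 3) ∷ (1 , 2) ∷ (1 , 3) ∷ []) 3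
    (nth-orderEmbedding Ls _ (ℕₚ.n<1+n b , b+1<x , ℕₚ.n<1+n x , tt) refl) refl refl [] [] j distinct (λ e ()))
  where
  Ls = b ∷ suc b ∷ x ∷ suc x ∷ []

qFam⁻-K4 : ∀ b x s → 3 ≤ s → Distinct (suc b ∷ x ∷ suc x ∷ []) → suc b < x → qFam⁻ b 2 ((suc b , x) ∷ []) s ≡ -[1+ 1 ]
qFam⁻-K4 b x s 3≤s distinct b+1<x = trans (cong (qList (suc b ∷ x ∷ suc x ∷ []) s) filtered)
  (offset-elim (λ s′ → qList (suc b ∷ x ∷ suc x ∷ []) s′ triangle ≡ -[1+ 1 ]) 3 s 3≤s (λ j →
    qList-block (nth Ls) (0 ∷ 1 ∷ 2 ∷ []) ((1 , 2) ∷ (0 , 1) ∷ (0 , 2) ∷ []) 3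
      (nth-orderEmbedding Ls _ (b+1<x , ℕₚ.n<1+n x , tt) refl) refl refl [] [] j distinct (λ e ())))
  where
  Ls = suc b ∷ x ∷ suc x ∷ []
  triangle = (x , suc x) ∷ (suc b , x) ∷ (suc b , suc x) ∷ []
  filtered : filterᵇ (avoids b) (familyEdges b 2 ((suc b , x) ∷ [])) ≡ triangle
  filtered = trans (filterᵇ-reject (avoids b) (b , suc b) _ (avoids-fst b (suc b)))
    (filterᵇ-avoids-house b x [] (ℕₚ.<-trans (ℕₚ.n<1+n b) b+1<x))

qFam-edge : ∀ b s → 1 ≤ s → qFam b 2 [] s ≡ -[1+ 0 ]
qFam-edge b s 1≤s = offset-elim (λ s′ → qFam b 2 [] s′ ≡ -[1+ 0 ]) 1 s 1≤s (λ j →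
  qList-block (nth (b ∷ suc b ∷ [])) (0 ∷ 1 ∷ []) ((0 , 1) ∷ []) 1
    (nth-orderEmbedding (b ∷ suc b ∷ []) _ (ℕₚ.n<1+n b , tt) refl) refl refl [] [] j
    ((λ { (here e) → ℕₚ.1+n≢n (sym e) }) , (λ ()) , tt) (λ e ()))

qFam⁻-edge : ∀ b s → qFam⁻ b 2 [] s ≡ ℤ.0ℤ
qFam⁻-edge b s = trans (cong (qList (suc b ∷ []) s) (filterᵇ-reject (avoids b) (b , suc b) [] (avoids-fst b (suc b))))
  (subst (λ s′ → qList (suc b ∷ []) s′ [] ≡ ℤ.0ℤ) (ℕₚ.+-identityʳ s)
    (qList-block (nth (suc b ∷ [])) (0 ∷ []) [] 0 (nth-orderEmbedding (suc b ∷ []) _ tt refl) refl refl [] [] s ((λ ()) , tt) (λ e ())))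

qFam-vertex : ∀ b s → qFam b 1 [] s ≡ ℤ.0ℤ
qFam-vertex b s = subst (λ s′ → qList (b ∷ []) s′ [] ≡ ℤ.0ℤ) (ℕₚ.+-identityʳ s)
  (qList-block (nth (b ∷ [])) (0 ∷ []) [] 0 (nth-orderEmbedding (b ∷ []) _ tt refl) refl refl [] [] s ((λ ()) , tt) (λ e ()))

-- Solving the transfer relations

qPath : ℕ → ℤ
qPath zero = ℤ.1ℤ
qPath (suc zero) = ℤ.0ℤ
qPath (suc (suc n)) = ℤ.- qPath n

qFamily : ℕ → ℕ → ℤ
qFamily L k = qPath L ℤ.* (+ 1 ℤ.+ + 2 ℤ.* + k) ℤ.+ qPath (suc L) ℤ.* (+ 2 ℤ.* + k)

qFamily⁻ : ℕ → ℕ → ℤ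
qFamily⁻ L k = qPath L ℤ.* (+ 2 ℤ.* + k) ℤ.+ qPath (suc L) ℤ.* (+ 2 ℤ.* + k ℤ.- + 1)

FamilyFormula : ℕ → ℕ → List (ℕ × ℕ) → ℕ → Set
FamilyFormula L b hs s = (qFam b L hs s ≡ qFamily L (length hs)) × (1 ≤ L → qFam⁻ b L hs s ≡ qFamily⁻ L (length hs))

path-recurrence : ∀ e o A B → (ℤ.- e) ℤ.* A ℤ.+ (ℤ.- o) ℤ.* B ≡ ℤ.- (e ℤ.* A ℤ.+ o ℤ.* B)
path-recurrence = solve 4 (λ e o A B → (:- e) :* A :+ (:- o) :* B := :- (e :* A :+ o :* B)) refl
  where open +-*-Solver

K4-recurrence : ∀ e o K →
  (ℤ.- e) ℤ.* (+ 1 ℤ.+ + 2 ℤ.* (+ 1 ℤ.+ K)) ℤ.+ (ℤ.- o) ℤ.* (+ 2 ℤ.* (+ 1 ℤ.+ K)) ≡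
  -[1+ 2 ] ℤ.* (e ℤ.* (+ 1 ℤ.+ + 2 ℤ.* K) ℤ.+ o ℤ.* (+ 2 ℤ.* K)) ℤ.+ + 2 ℤ.* (e ℤ.* (+ 2 ℤ.* K) ℤ.+ o ℤ.* (+ 2 ℤ.* K ℤ.- + 1))
K4-recurrence = solve 3 (λ e o K →
  (:- e) :* (con (+ 1) :+ con (+ 2) :* (con (+ 1) :+ K)) :+ (:- o) :* (con (+ 2) :* (con (+ 1) :+ K)) :=
  con -[1+ 2 ] :* (e :* (con (+ 1) :+ con (+ 2) :* K) :+ o :* (con (+ 2) :* K)) :+
    con (+ 2) :* (e :* (con (+ 2) :* K) :+ o :* (con (+ 2) :* K :- con (+ 1)))) refl
  where open +-*-Solver

K4⁻-recurrence : ∀ e o K →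
  (ℤ.- e) ℤ.* (+ 2 ℤ.* (+ 1 ℤ.+ K)) ℤ.+ (ℤ.- o) ℤ.* (+ 2 ℤ.* (+ 1 ℤ.+ K) ℤ.- + 1) ≡
  -[1+ 1 ] ℤ.* (e ℤ.* (+ 1 ℤ.+ + 2 ℤ.* K) ℤ.+ o ℤ.* (+ 2 ℤ.* K)) ℤ.+ (e ℤ.* (+ 2 ℤ.* K) ℤ.+ o ℤ.* (+ 2 ℤ.* K ℤ.- + 1))
K4⁻-recurrence = solve 3 (λ e o K →
  (:- e) :* (con (+ 2) :* (con (+ 1) :+ K)) :+ (:- o) :* (con (+ 2) :* (con (+ 1) :+ K) :- con (+ 1)) :=
  con -[1+ 1 ] :* (e :* (con (+ 1) :+ con (+ 2) :* K) :+ o :* (con (+ 2) :* K)) :+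
    (e :* (con (+ 2) :* K) :+ o :* (con (+ 2) :* K :- con (+ 1)))) refl
  where open +-*-Solver

familyFormula-path : ∀ L b hs s →
  (qFam b (suc (suc (suc L))) hs s ≡ ℤ.- qFam (suc (suc b)) (suc L) hs s) →
  (qFam⁻ b (suc (suc (suc L))) hs s ≡ ℤ.- qFam⁻ (suc (suc b)) (suc L) hs s) →
  FamilyFormula (suc L) (suc (suc b)) hs s → FamilyFormula (suc (suc (suc L))) b hs s
familyFormula-path L b hs s step step⁻ (ih , ih⁻) =
  trans step (trans (cong ℤ.-_ ih) (sym (path-recurrence e o (+ 1 ℤ.+ + 2 ℤ.* K) (+ 2 ℤ.* K)))) ,
  λ _ → trans step⁻ (trans (cong ℤ.-_ (ih⁻ (s≤s z≤n))) (sym (path-recurrence e o (+ 2 ℤ.* K) (+ 2 ℤ.* K ℤ.- + 1))))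
  where
  e = qPath (suc L)
  o = qPath (suc (suc L))
  K = + length hs

familyFormula-K4 : ∀ L b x hs s →
  (qFam b (suc (suc (suc L))) ((suc b , x) ∷ hs) s ≡
    -[1+ 2 ] ℤ.* qFam (suc (suc b)) (suc L) hs s ℤ.+ + 2 ℤ.* qFam⁻ (suc (suc b)) (suc L) hs s) →
  (qFam⁻ b (suc (suc (suc L))) ((suc b , x) ∷ hs) s ≡
    -[1+ 1 ] ℤ.* qFam (suc (suc b)) (suc L) hs s ℤ.+ qFam⁻ (suc (suc b)) (suc L) hs s) →
  FamilyFormula (suc L) (suc (suc b)) hs s → FamilyFormula (suc (suc (suc L))) b ((suc b , x) ∷ hs) s
familyFormula-K4 L b x hs s step step⁻ (ih , ih⁻) =
  trans step (trans (cong₂ (λ X Y → -[1+ 2 ] ℤ.* X ℤ.+ + 2 ℤ.* Y) ih (ih⁻ (s≤s z≤n))) (sym (K4-recurrence e o K))) ,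
  λ _ → trans step⁻ (trans (cong₂ (λ X Y → -[1+ 1 ] ℤ.* X ℤ.+ Y) ih (ih⁻ (s≤s z≤n))) (sym (K4⁻-recurrence e o K)))
  where
  e = qPath (suc L)
  o = qPath (suc (suc L))
  K = + length hs

odd-offset-cases : ∀ b a t → a ≡ suc (b + 2 * t) → (a ≡ suc b) ⊎ (Σ ℕ λ t′ → a ≡ suc (suc (suc b) + 2 * t′))
odd-offset-cases b a zero e = inj₁ (trans e (cong suc (ℕₚ.+-identityʳ b)))
odd-offset-cases b a (suc t) e = inj₂ (t , trans e (cong suc (trans (cong (_+_ b) (ℕₚ.*-suc 2 t))
  (trans (ℕₚ.+-suc b (suc (2 * t))) (cong suc (ℕₚ.+-suc b (2 * t)))))))

no-house-below : ∀ c top xlo a x hs → WellPlaced c top xlo ((a , x) ∷ hs) → top ≤ suc c → ⊥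
no-house-below c top xlo a x hs ((t , refl) , a<top , _) top≤ =
  ℕₚ.<-irrefl refl (ℕₚ.≤-trans (s≤s (ℕₚ.m≤m+n c (2 * t))) (ℕₚ.≤-pred (ℕₚ.≤-trans a<top top≤)))

≤-through : ∀ {n} L k {s} → n ≤ L → L + k ≤ s → n ≤ s
≤-through L k n≤L size = ℕₚ.≤-trans n≤L (ℕₚ.≤-trans (ℕₚ.m≤m+n L k) size)

familyFormula-step : ∀ L b hs xlo s → b + suc (suc (suc L)) ≤ xlo → WellPlaced b (b + suc (suc (suc L))) xlo hs →
  suc (suc (suc L)) + 2 * length hs ≤ s →
  (∀ hs′ xlo′ → suc (suc b) + suc L ≤ xlo′ → WellPlaced (suc (suc b)) (suc (suc b) + suc L) xlo′ hs′ →
     suc L + 2 * length hs′ ≤ s → FamilyFormula (suc L) (suc (suc b)) hs′ s) →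
  FamilyFormula (suc (suc (suc L))) b hs s
familyFormula-step L b [] xlo s top≤xlo _ size ih =
  familyFormula-path L b [] s (qFam-path-step b L [] xlo rest≤ tt s 2≤s) (qFam⁻-path-step b L [] xlo rest≤ tt s 2≤s)
    (ih [] xlo rest≤ tt (ℕₚ.≤-trans (ℕₚ.n≤1+n _) (ℕₚ.≤-trans (ℕₚ.n≤1+n _) size)))
  where
  rest≤ = ℕₚ.≤-trans (ℕₚ.≤-reflexive (sym (top-shift b L))) top≤xlo
  2≤s = ≤-through (suc (suc (suc L))) 0 (s≤s (s≤s z≤n)) size
familyFormula-step L b ((a , x) ∷ hs) xlo s top≤xlo wp@((t , a≡) , a<top , xlo≤x , wpRest) size ih
  with odd-offset-cases b a t a≡
... | inj₂ (t′ , a≡′) =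
  familyFormula-path L b ((a , x) ∷ hs) s (qFam-path-step b L _ xlo rest≤ wp′ s 2≤s) (qFam⁻-path-step b L _ xlo rest≤ wp′ s 2≤s)
    (ih ((a , x) ∷ hs) xlo rest≤ wp′ (ℕₚ.≤-trans (ℕₚ.n≤1+n _) (ℕₚ.≤-trans (ℕₚ.n≤1+n _) size)))
  where
  rest≤ = ℕₚ.≤-trans (ℕₚ.≤-reflexive (sym (top-shift b L))) top≤xlo
  2≤s = ≤-through (suc (suc (suc L))) (2 * length ((a , x) ∷ hs)) (s≤s (s≤s z≤n)) size
  wp′ : WellPlaced (suc (suc b)) (suc (suc b) + suc L) xlo ((a , x) ∷ hs)
  wp′ = (t′ , a≡′) , subst (a <_) (top-shift b L) a<top , xlo≤x ,
        subst (λ top → WellPlaced (suc a) top (suc (suc x)) hs) (top-shift b L) wpRest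
... | inj₁ refl =
  familyFormula-K4 L b x hs s (qFam-K4-step b L x hs xlo s top≤xlo wp 3≤s) (qFam⁻-K4-step b L x hs xlo s top≤xlo wp 3≤s)
    (ih hs (suc (suc x)) rest≤ wp′ (ℕₚ.≤-trans (ℕₚ.+-mono-≤ (ℕₚ.≤-trans (ℕₚ.n≤1+n _) (ℕₚ.n≤1+n _))
                                         (ℕₚ.≤-trans (ℕₚ.n≤1+n _) (ℕₚ.≤-trans (ℕₚ.n≤1+n _) (ℕₚ.≤-reflexive (sym (ℕₚ.*-suc 2 (length hs)))))))
                                      size))
  where
  rest≤ = ℕₚ.≤-trans (ℕₚ.≤-reflexive (sym (top-shift b L)))
            (ℕₚ.≤-trans top≤xlo (ℕₚ.≤-trans xlo≤x (ℕₚ.≤-trans (ℕₚ.n≤1+n x) (ℕₚ.n≤1+n (suc x)))))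
  3≤s = ≤-through (suc (suc (suc L))) (2 * length ((suc b , x) ∷ hs)) (s≤s (s≤s (s≤s z≤n))) size
  wp′ : WellPlaced (suc (suc b)) (suc (suc b) + suc L) (suc (suc x)) hs
  wp′ = subst (λ top → WellPlaced (suc (suc b)) top (suc (suc x)) hs) (top-shift b L) wpRest

familyFormula : ∀ L b hs xlo s → b + L ≤ xlo → WellPlaced b (b + L) xlo hs → L + 2 * length hs ≤ s → FamilyFormula L b hs s
familyFormula zero b [] xlo s _ _ _ = refl , (λ ())
familyFormula zero b ((a , x) ∷ hs) xlo s _ wp _ =
  ⊥-elim (no-house-below b (b + 0) xlo a x hs wp (ℕₚ.≤-trans (ℕₚ.≤-reflexive (ℕₚ.+-identityʳ b)) (ℕₚ.n≤1+n b)))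
familyFormula (suc zero) b [] xlo s _ _ _ = qFam-vertex b s , (λ _ → refl)
familyFormula (suc zero) b ((a , x) ∷ hs) xlo s _ wp _ = ⊥-elim (no-house-below b (b + 1) xlo a x hs wp (ℕₚ.≤-reflexive (ℕₚ.+-comm b 1)))
familyFormula (suc (suc zero)) b [] xlo s _ _ size = qFam-edge b s (ℕₚ.≤-trans (s≤s z≤n) size) , (λ _ → qFam⁻-edge b s)
familyFormula (suc (suc zero)) b ((a , x) ∷ hs) xlo s top≤xlo wp@((t , a≡) , a<top , xlo≤x , wpRest) size
  with odd-offset-cases b a t a≡
... | inj₂ (t′ , refl) =
  ⊥-elim (ℕₚ.<-irrefl refl (ℕₚ.≤-trans a<top (ℕₚ.≤-trans (ℕₚ.≤-reflexive (ℕₚ.+-comm b 2)) (s≤s (s≤s (ℕₚ.≤-trans (ℕₚ.m≤m+n b (2 * t′)) (ℕₚ.n≤1+n _)))))))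
familyFormula (suc (suc zero)) b ((a , x) ∷ (a′ , x′) ∷ hs) xlo s top≤xlo wp@(_ , _ , _ , wpRest) size | inj₁ refl =
  ⊥-elim (no-house-below (suc (suc b)) (b + 2) (suc (suc x)) a′ x′ hs wpRest (ℕₚ.≤-trans (ℕₚ.≤-reflexive (ℕₚ.+-comm b 2)) (ℕₚ.n≤1+n _)))
familyFormula (suc (suc zero)) b ((a , x) ∷ []) xlo s top≤xlo wp@(_ , _ , xlo≤x , _) size | inj₁ refl =
  qFam-K4 b x s 3≤s distinct b+1<x , (λ _ → qFam⁻-K4 b x s 3≤s (proj₂ distinct) b+1<x)
  where
  3≤s = ℕₚ.≤-trans (s≤s (s≤s (s≤s z≤n))) size
  distinct = Distinct-familyVertices b 2 xlo ((suc b , x) ∷ []) top≤xlo wp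
  b+1<x : suc b < x
  b+1<x = ℕₚ.≤-trans (ℕₚ.≤-reflexive (ℕₚ.+-comm 2 b)) (ℕₚ.≤-trans top≤xlo xlo≤x)
familyFormula (suc (suc (suc L))) b hs xlo s top≤xlo wp size =
  familyFormula-step L b hs xlo s top≤xlo wp size (λ hs′ xlo′ → familyFormula (suc L) (suc (suc b)) hs′ xlo′ s)

-- From Q to the family

applyUpTo-range : ∀ n (f : ℕ → ℕ) b → (∀ i → f i ≡ b + i) → applyUpTo f n ≡ range b n
applyUpTo-range zero f b h = refl
applyUpTo-range (suc n) f b h = cong₂ _∷_ (trans (h 0) (ℕₚ.+-identityʳ b))
  (applyUpTo-range n (λ i → f (suc i)) (suc b) (λ i → trans (h (suc i)) (ℕₚ.+-suc b i)))

upTo-range : ∀ n → upTo n ≡ range 0 n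
upTo-range n = applyUpTo-range n (λ i → i) 0 (λ i → refl)

range-++ : ∀ b L M → range b (L + M) ≡ range b L ++ range (b + L) M
range-++ b zero M = cong (λ c → range c M) (sym (ℕₚ.+-identityʳ b))
range-++ b (suc L) M = cong (b ∷_) (trans (range-++ (suc b) L M) (cong (λ c → range (suc b) L ++ range c M) (sym (ℕₚ.+-suc b L))))

pathEdges≡pathEdgesFrom : ∀ b L → map (λ j → (j , suc j)) (range b (L ∸ 1)) ≡ pathEdgesFrom b L
pathEdges≡pathEdgesFrom b zero = refl
pathEdges≡pathEdgesFrom b (suc zero) = refl
pathEdges≡pathEdgesFrom b (suc (suc L)) = cong ((b , suc b) ∷_) (pathEdges≡pathEdgesFrom (suc b) (suc L))

houseEdgeList-map : ∀ {A : Set} (F : A → ℕ × ℕ) xs → houseEdgeList (map F xs) ≡ concatMap (λ i → houseEdgesAt (F i)) xs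
houseEdgeList-map F [] = refl
houseEdgeList-map F (x ∷ xs) = cong (houseEdgesAt (F x) ++_) (houseEdgeList-map F xs)

map-allFin-suc : ∀ {B : Set} k (F : Fin (suc k) → B) → map F (allFin (suc k)) ≡ F fz ∷ map (λ i → F (fs i)) (allFin k)
map-allFin-suc k F = cong (F fz ∷_) (trans (Listₚ.map-tabulate fs F) (sym (Listₚ.map-tabulate (λ i → i) (λ i → F (fs i)))))

length-map-allFin : ∀ {B : Set} k (F : Fin k → B) → length (map F (allFin k)) ≡ k
length-map-allFin k F = trans (Listₚ.length-map F (allFin k)) (Listₚ.length-tabulate (λ i → i))

houseVertices-range : ∀ k (F : Fin k → ℕ × ℕ) c → (∀ i → proj₂ (F i) ≡ c + 2 * toℕ i) →
  houseVertices (map F (allFin k)) ≡ range c (2 * k)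
houseVertices-range zero F c h = refl
houseVertices-range (suc k) F c h = begin
  houseVertices (map F (allFin (suc k)))
    ≡⟨ cong houseVertices (map-allFin-suc k F) ⟩
  proj₂ (F fz) ∷ suc (proj₂ (F fz)) ∷ houseVertices (map (λ i → F (fs i)) (allFin k))
    ≡⟨ cong (λ z → z ∷ suc z ∷ houseVertices (map (λ i → F (fs i)) (allFin k))) (trans (h fz) (ℕₚ.+-identityʳ c)) ⟩
  c ∷ suc c ∷ houseVertices (map (λ i → F (fs i)) (allFin k))
    ≡⟨ cong (λ z → c ∷ suc c ∷ z) (houseVertices-range k (λ i → F (fs i)) (suc (suc c)) (λ i → trans (h (fs i)) (shift (toℕ i)))) ⟩
  range c (suc (suc (2 * k)))
    ≡⟨ cong (range c) (sym (ℕₚ.*-suc 2 k)) ⟩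
  range c (2 * suc k) ∎
  where
  open ≡-Reasoning
  shift : ∀ i → c + 2 * suc i ≡ suc (suc c) + 2 * i
  shift i = trans (cong (_+_ c) (ℕₚ.*-suc 2 i)) (trans (ℕₚ.+-suc c (suc (2 * i))) (cong suc (ℕₚ.+-suc c (2 * i))))

wellPlaced-houses : ∀ k (F : Fin k → ℕ × ℕ) b u top xlo c → b ≡ 2 * u →
  (∀ i → ∃ λ t → proj₁ (F i) ≡ 2 * t + 1) → (∀ i → proj₁ (F i) < top) →
  (∀ (i j : Fin k) → toℕ j ≡ suc (toℕ i) → proj₁ (F i) + 2 ≤ proj₁ (F j)) →
  (∀ (i : Fin k) → toℕ i ≡ 0 → b < proj₁ (F i)) →
  (∀ i → proj₂ (F i) ≡ c + 2 * toℕ i) → xlo ≤ c →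
  WellPlaced b top xlo (map F (allFin k))
wellPlaced-houses zero F b u top xlo c b≡ odd <top gap first x≡ xlo≤c = tt
wellPlaced-houses (suc k) F b u top xlo c refl odd <top gap first x≡ xlo≤c =
  subst (WellPlaced (2 * u) top xlo) (sym (map-allFin-suc k F))
    ((t₀ ∸ u , offset) , <top fz , subst (xlo ≤_) (sym (trans (x≡ fz) (ℕₚ.+-identityʳ c))) xlo≤c ,
     wellPlaced-houses k (λ i → F (fs i)) (suc a₀) (suc t₀) top (suc (suc x₀)) (suc (suc c))
       next-even (λ i → odd (fs i)) (λ i → <top (fs i)) (λ i j e → gap (fs i) (fs j) (cong suc e))
       (λ i e → ℕₚ.≤-trans (ℕₚ.≤-reflexive (ℕₚ.+-comm 2 a₀)) (gap fz (fs i) (cong suc e)))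
       (λ i → trans (x≡ (fs i)) (shift (toℕ i))) (s≤s (s≤s (ℕₚ.≤-reflexive (trans (x≡ fz) (ℕₚ.+-identityʳ c))))))
  where
  a₀ = proj₁ (F fz)
  x₀ = proj₂ (F fz)
  t₀ = proj₁ (odd fz)
  a₀≡ : a₀ ≡ suc (2 * t₀)
  a₀≡ = trans (proj₂ (odd fz)) (ℕₚ.+-comm (2 * t₀) 1)
  u≤t₀ : u ≤ t₀
  u≤t₀ = ℕₚ.*-cancelˡ-≤ 2 (ℕₚ.≤-pred (subst (suc (2 * u) ≤_) a₀≡ (first fz refl)))
  offset : a₀ ≡ suc (2 * u + 2 * (t₀ ∸ u))
  offset = trans a₀≡ (cong suc (trans (cong (2 *_) (sym (ℕₚ.m+[n∸m]≡n u≤t₀))) (ℕₚ.*-distribˡ-+ 2 u (t₀ ∸ u))))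
  next-even : suc a₀ ≡ 2 * suc t₀
  next-even = trans (cong suc a₀≡) (sym (ℕₚ.*-suc 2 t₀))
  shift : ∀ i → c + 2 * suc i ≡ suc (suc c) + 2 * i
  shift i = trans (cong (_+_ c) (ℕₚ.*-suc 2 i)) (trans (ℕₚ.+-suc c (suc (2 * i))) (cong suc (ℕₚ.+-suc c (2 * i))))

q≡qFamily : ∀ m (r : ℤ) k (a : Fin k → ℕ) → + m ≡ r ℤ.+ ℤ.1ℤ → (∀ i → + (a i) ℤ.≤ r) →
  (∀ (i j : Fin k) → toℕ j ≡ suc (toℕ i) → a i + 2 ≤ a j) → (∀ i → ∃ λ t → a i ≡ 2 * t + 1) → q r k a ≡ qFamily m k
q≡qFamily m r k a m≡ a≤r gap odd = begin
  q r k a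
    ≡⟨ cong (λ z → qG (Qm ∣ z ∣ k a)) (sym m≡) ⟩
  qG (Qm m k a)
    ≡⟨ q≡qList (m + 2 * k) E ⟩
  qList (upTo (m + 2 * k)) (m + 2 * k) E
    ≡⟨ cong₂ (λ V E′ → qList V (m + 2 * k) E′) vertices≡ edges≡ ⟩
  qFam 0 m hs (m + 2 * k)
    ≡⟨ proj₁ (familyFormula m 0 hs m (m + 2 * k) ℕₚ.≤-refl wellPlaced (ℕₚ.≤-reflexive (cong (λ z → m + 2 * z) (length-map-allFin k F)))) ⟩
  qFamily m (length hs)
    ≡⟨ cong (qFamily m) (length-map-allFin k F) ⟩
  qFamily m k ∎
  where
  open ≡-Reasoning
  F : Fin k → ℕ × ℕ
  F i = (a i , m + 2 * toℕ i)
  hs = map F (allFin k)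
  E = pathEdges m ++ concatMap (houseEdges m a) (allFin k)
  vertices≡ : upTo (m + 2 * k) ≡ familyVertices 0 m hs
  vertices≡ = trans (upTo-range _) (trans (range-++ 0 m (2 * k)) (cong (range 0 m ++_) (sym (houseVertices-range k F m (λ i → refl)))))
  edges≡ : E ≡ familyEdges 0 m hs
  edges≡ = cong₂ _++_ (trans (cong (map (λ j → (j , suc j))) (upTo-range (m ∸ 1))) (pathEdges≡pathEdgesFrom 0 m))
                      (sym (houseEdgeList-map F (allFin k)))
  a<m : ∀ i → a i < m
  a<m i = subst (_≤ m) (ℕₚ.+-comm (a i) 1) (ℤₚ.drop‿+≤+ (subst (ℤ._≤_ (+ (a i + 1))) (sym m≡) (ℤₚ.+-monoˡ-≤ ℤ.1ℤ (a≤r i))))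
  wellPlaced : WellPlaced 0 m m hs
  wellPlaced = wellPlaced-houses k F 0 0 m m m refl odd a<m gap
    (λ i _ → subst (0 <_) (sym (proj₂ (odd i))) (subst (0 <_) (ℕₚ.+-comm 1 (2 * proj₁ (odd i))) (s≤s z≤n))) (λ i → refl) ℕₚ.≤-refl

qPath-even : ∀ t → qPath (2 * t) ≡ (ℤ.- ℤ.1ℤ) ℤ.^ t
qPath-even zero = refl
qPath-even (suc t) rewrite ℕₚ.*-suc 2 t = trans (cong ℤ.-_ (qPath-even t)) (sym (ℤₚ.-1*i≡-i _))

qPath-odd : ∀ t → qPath (suc (2 * t)) ≡ ℤ.0ℤ
qPath-odd zero = refl
qPath-odd (suc t) = trans (cong (λ n → qPath (suc n)) (ℕₚ.*-suc 2 t)) (cong ℤ.-_ (qPath-odd t))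

qFamily-odd : ∀ t k → qFamily (2 * t + 1) k ≡ + (2 * k) ℤ.* (ℤ.- ℤ.1ℤ) ℤ.^ (t + 1)
qFamily-odd t k rewrite ℕₚ.+-comm (2 * t) 1 | ℕₚ.+-comm t 1 | qPath-odd t | qPath-even t | ℤₚ.+◃n≡+n (2 * k) =
  rearrange ((ℤ.- ℤ.1ℤ) ℤ.^ t) (+ (2 * k))
  where
  open +-*-Solver
  rearrange : ∀ x K → ℤ.0ℤ ℤ.* (+ 1 ℤ.+ K) ℤ.+ (ℤ.- x) ℤ.* K ≡ K ℤ.* (-[1+ 0 ] ℤ.* x)
  rearrange = solve 2 (λ x K → con ℤ.0ℤ :* (con (+ 1) :+ K) :+ (:- x) :* K := K :* (con -[1+ 0 ] :* x)) refl

qFamily-even : ∀ t k → qFamily (2 * t) k ≡ + (2 * k + 1) ℤ.* (ℤ.- ℤ.1ℤ) ℤ.^ t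
qFamily-even t k rewrite ℕₚ.+-comm (2 * k) 1 | qPath-even t | qPath-odd t | ℤₚ.+◃n≡+n (2 * k) =
  rearrange ((ℤ.- ℤ.1ℤ) ℤ.^ t) (+ (2 * k))
  where
  open +-*-Solver
  rearrange : ∀ x K → x ℤ.* (+ 1 ℤ.+ K) ℤ.+ ℤ.0ℤ ℤ.* K ≡ (+ 1 ℤ.+ K) ℤ.* x
  rearrange = solve 2 (λ x K → x :* (con (+ 1) :+ K) :+ con ℤ.0ℤ :* K := (con (+ 1) :+ K) :* x) refl

corollary6p7 : (r : ℤ) (k : ℕ) (a : Fin k → ℕ) →
    -[1+ 0 ] ℤ.≤ r →
    (∀ i → 1 ≤ a i) →
    (∀ i → + (a i) ℤ.≤ r) →
    (∀ (i j : Fin k) → toℕ j ≡ suc (toℕ i) → a i + 2 ≤ a j) →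
    (∀ i → ∃ λ t → a i ≡ 2 * t + 1) →
    ((t : ℕ) → r ≡ + (2 * t) →
      q r k a ≡ + (2 * k) ℤ.* (ℤ.- ℤ.1ℤ) ℤ.^ (t + 1))
    × ((t : ℕ) → r ≡ + (2 * t) ℤ.- ℤ.1ℤ →
      q r k a ≡ + (2 * k + 1) ℤ.* (ℤ.- ℤ.1ℤ) ℤ.^ t)
corollary6p7 r k a _ _ a≤r gap odd = even-r , odd-r
  where
  even-r : (t : ℕ) → r ≡ + (2 * t) → q r k a ≡ + (2 * k) ℤ.* (ℤ.- ℤ.1ℤ) ℤ.^ (t + 1)
  even-r t r≡ = trans (q≡qFamily (2 * t + 1) r k a (sym (cong (ℤ._+ ℤ.1ℤ) r≡)) a≤r gap odd) (qFamily-odd t k)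
  odd-r : (t : ℕ) → r ≡ + (2 * t) ℤ.- ℤ.1ℤ → q r k a ≡ + (2 * k + 1) ℤ.* (ℤ.- ℤ.1ℤ) ℤ.^ t
  odd-r t r≡ = trans (q≡qFamily (2 * t) r k a r+1≡ a≤r gap odd) (qFamily-even t k)
    where
    r+1≡ : + (2 * t) ≡ r ℤ.+ ℤ.1ℤ
    r+1≡ = sym (trans (cong (ℤ._+ ℤ.1ℤ) r≡) (trans (ℤₚ.+-assoc (+ (2 * t)) (ℤ.- ℤ.1ℤ) ℤ.1ℤ) (ℤₚ.+-identityʳ _)))
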